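{- Let $n\ge3$ be an integer and let $r$ be a positive integer. Let $T=[C_n,\{f_{v_i}\}_{i=1}^n,\mathrm{id}]\colon\mathbb F_2^n\to\mathbb F_2^n$, where $f_{v_i}\in\{\mathrm{parity}_3,(1+\mathrm{parity})_3\}$ for all $i$. If $T$ has a fixed point, then \[|\mathrm{Per}_r(T)|=\begin{cases}\sum_{d\mid r}\mu(r/d)2^{d+1}, & \text{if } r\mid n-1\text{ and } n\equiv0\pmod2;\\ \sum_{d\mid r}\mu(r/d)\xi_n(d), & \text{if } r\mid 2n-2 \text{ and } n\equiv 1\pmod 2;\\ 0, & \text{otherwise}.\end{cases}\] If $T$ does not have a fixed point, then \[|\mathrm{Per}_r(T)|=\begin{cases}\sum_{d\mid_o r}\mu(r/d)2^{\frac d2+1}, & \text{if } r\mid_o 2n-2;\\ 0, & \text{otherwise}.\end{cases}\]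
   Context: $C_n$ is the cycle graph with vertices $v_1,\dots,v_n$, $v_i$ adjacent to $v_j$ iff $i-j\equiv\pm1\pmod n$. $\mathrm{parity}_3(x,y,z)=x+y+z$ and $(1+\mathrm{parity})_3(x,y,z)=1+x+y+z$ over $\mathbb F_2$. For $x=(x_1,\dots,x_n)\in\mathbb F_2^n$, the local update $F_{v_i}$ replaces $x_i$ by $f_{v_i}(x_{i-1},x_i,x_{i+1})$ (indices mod $n$) and leaves other coordinates unchanged; $T=[C_n,\{f_{v_i}\},\mathrm{id}]=F_{v_n}\circ\cdots\circ F_{v_1}$. A point $x$ is a periodic point of $T$ of period $r$ if $T^r(x)=x$ and $T^s(x)\ne x$ for all positive $s<r$; $\mathrm{Per}_r(T)$ is the set of such points. $\mu$ is the number-theoretic Möbius function. For nonzero integers $k,m$, $k\mid_o m$ means $m/k$ is an odd integer, and $\sum_{d\mid_o r}$ runs over positive $d$ with $r/d$ odd. For a positive integer $k$, $\xi_n(k)=2^k$ if $k\mid n-1$ and $\xi_n(k)=2^{\frac k2+1}$ if $k\nmid n-1$. -}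

module Defs where

open import Data.Bool using (Bool; true; false; _xor_; if_then_else_)
open import Data.Nat using (ℕ; zero; suc; _+_; _*_; _∸_; _^_; _≤_; _<_; s≤s; z≤n; _/_; _%_)
open import Data.Nat.Properties using (m≤m*n; ≤-trans; ≤-refl; n<1+n)
import Data.Nat.Properties as ℕP
open import Data.Nat.Divisibility using (_∣_; _∣?_)
open import Data.Nat.Primality using (Prime; prime?)
open import Data.Nat.Induction using ()
open import Data.Integer using (ℤ; +_; -_)
import Data.Integer as ℤ
open import Data.Fin using (Fin; toℕ; fromℕ<; fromℕ)
import Data.Fin as Fin
open import Data.Fin.Properties using (all?; any?; toℕ-fromℕ<; toℕ<n)
open import Data.Vec using (Vec; []; _∷_; lookup; _[_]≔_)
open import Data.Vec.Properties using (≡-dec)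
open import Data.List using (List; []; _∷_; length; filter; map; upTo; allFin; foldl; _++_)
open import Data.Product using (Σ; _×_; _,_; proj₁; proj₂; ∃)
open import Function using (_∘_)
open import Relation.Nullary using (Dec; yes; no; ¬_)
open import Relation.Nullary.Decidable using (⌊_⌋; _×-dec_; map′)
open import Relation.Binary.PropositionalEquality using (_≡_; _≢_; refl; sym; trans; subst; cong)
import Data.Bool.Properties as BoolP
import Data.Nat.DivMod as DM

Even : ℕ → Set
Even n = 2 ∣ n

Odd : ℕ → Set
Odd n = ¬ (2 ∣ n)

_∣ₒ_ : ℕ → ℕ → Set
k ∣ₒ m = Σ ℕ λ q → (m ≡ q * k) × Odd q

private
  Odd? : (q : ℕ) → Dec (Odd q)
  Odd? q with 2 ∣? q
  ... | yes p = no (λ h → h p)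
  ... | no p  = yes p

∣ₒ? : (j m : ℕ) → Dec (suc j ∣ₒ m)
∣ₒ? j m = map′ to from (any? {n = suc m} (λ q → (m ℕP.≟ toℕ q * suc j) ×-dec Odd? (toℕ q)))
  where
  to : ∃ (λ (q : Fin (suc m)) → (m ≡ toℕ q * suc j) × Odd (toℕ q)) → suc j ∣ₒ m
  to (q , e , o) = toℕ q , e , o
  from : suc j ∣ₒ m → ∃ (λ (q : Fin (suc m)) → (m ≡ toℕ q * suc j) × Odd (toℕ q))
  from (q , e , o) = fromℕ< q<sm , subst (λ t → m ≡ t * suc j) (sym (toℕ-fromℕ< q<sm)) e
                                  , subst Odd (sym (toℕ-fromℕ< q<sm)) o
    where
    q≤m : q ≤ m
    q≤m = subst (q ≤_) (sym e) (m≤m*n q (suc j))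
    q<sm : q < suc m
    q<sm = s≤s q≤m

-- Möbius function μ : ℕ → ℤ (only meaningful for positive arguments):
-- μ(n) = 0 if p² ∣ n for some prime p, else (-1)^(number of prime divisors of n).

private
  primeDivisors : ℕ → List ℕ
  primeDivisors n = filter (λ p → prime? p ×-dec (p ∣? n)) (upTo (suc n))

  squareful : ℕ → Bool
  squareful n = ⌊ Data.List.Relation.Unary.Any.any? (λ p → p * p ∣? n) (primeDivisors n) ⌋
    where import Data.List.Relation.Unary.Any

  negOnePow : ℕ → ℤ
  negOnePow zero = + 1
  negOnePow (suc k) = - negOnePow k

μ : ℕ → ℤ
μ n = if squareful n then + 0 else negOnePow (length (primeDivisors n))

-- Divisor sums.  divSum r f = Σ_{d ∣ r, d ≥ 1} f d (r / d)
-- oddDivSum r f = Σ_{d ∣ₒ r, d ≥ 1} f d (r / d)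
-- (the second argument passed to f is the quotient r / d)

sumℤ : List ℤ → ℤ
sumℤ = Data.List.foldr ℤ._+_ (+ 0)

divSum : ℕ → (ℕ → ℕ → ℤ) → ℤ
divSum r f = sumℤ (map (λ k → if ⌊ suc k ∣? r ⌋ then f (suc k) (r / suc k) else + 0) (upTo r))

oddDivSum : ℕ → (ℕ → ℕ → ℤ) → ℤ
oddDivSum r f = sumℤ (map (λ k → if ⌊ ∣ₒ? k r ⌋ then f (suc k) (r / suc k) else + 0) (upTo r))

-- ξ_n(k) = 2^k if k ∣ n - 1, and 2^(k/2 + 1) otherwise
-- (⌊k/2⌋; in the theorem k is even whenever the second branch is used).
ξ : ℕ → ℕ → ℤ
ξ n k = if ⌊ k ∣? (n ∸ 1) ⌋ then + (2 ^ k) else + (2 ^ (k / 2 + 1))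

data LocalFn : Set where
  parity₃ oneParity₃ : LocalFn

evalFn : LocalFn → Bool → Bool → Bool → Bool
evalFn parity₃    a b c = a xor b xor c
evalFn oneParity₃ a b c = true xor (a xor b xor c)

-- cyclic neighbours in the cycle C_n (vertices indexed 0,…,n-1 by Fin n;
-- Fin-index i corresponds to the paper's v_{i+1})
prevV : ∀ {n} → Fin n → Fin n
prevV {suc m} i = ((toℕ i + m) DM.mod (suc m))

nextV : ∀ {n} → Fin n → Fin n
nextV {suc m} i = ((toℕ i + 1) DM.mod (suc m))

localUpdate : ∀ {n} → (Fin n → LocalFn) → Fin n → Vec Bool n → Vec Bool n
localUpdate f i x = x [ i ]≔ evalFn (f i) (lookup x (prevV i)) (lookup x i) (lookup x (nextV i))

-- T = F_{v_n} ∘ ⋯ ∘ F_{v_1}  (F_{v_1} applied first)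
SDS : ∀ {n} → (Fin n → LocalFn) → Vec Bool n → Vec Bool n
SDS {n} f x = foldl (λ y i → localUpdate f i y) x (allFin n)

iterate : ∀ {A : Set} → (A → A) → ℕ → A → A
iterate g zero x = x
iterate g (suc k) x = g (iterate g k x)

IsPeriodic : ∀ {n} → (Vec Bool n → Vec Bool n) → ℕ → Vec Bool n → Set
IsPeriodic T r x = (iterate T r x ≡ x) × (∀ s → 0 < s → s < r → iterate T s x ≢ x)

HasFixedPoint : ∀ {n} → (Vec Bool n → Vec Bool n) → Set
HasFixedPoint {n} T = Σ (Vec Bool n) λ x → T x ≡ x

isPeriodic? : ∀ {n} (T : Vec Bool n → Vec Bool n) (r : ℕ) (x : Vec Bool n) → Dec (IsPeriodic T r x)
isPeriodic? T r x = ≡-dec BoolP._≟_ (iterate T r x) x ×-dec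
  map′ to from (all? {n = r} (λ i → pos? (toℕ i) (λ p → neq? (toℕ i))))
  where
  neq? : ∀ s → Dec (iterate T s x ≢ x)
  neq? s with ≡-dec BoolP._≟_ (iterate T s x) x
  ... | yes p = no (λ h → h p)
  ... | no p  = yes p
  pos? : ∀ s {P : Set} → (0 < s → Dec P) → Dec (0 < s → P)
  pos? zero d = yes (λ ())
  pos? (suc s) d with d (s≤s z≤n)
  ... | yes p = yes (λ _ → p)
  ... | no p  = no (λ h → p (h (s≤s z≤n)))
  to : (∀ (i : Fin r) → 0 < toℕ i → iterate T (toℕ i) x ≢ x) → ∀ s → 0 < s → s < r → iterate T s x ≢ x
  to h s p q = subst (λ t → iterate T t x ≢ x) (toℕ-fromℕ< q)
                 (h (fromℕ< q) (subst (0 <_) (sym (toℕ-fromℕ< q)) p))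
  from : (∀ s → 0 < s → s < r → iterate T s x ≢ x) → ∀ (i : Fin r) → 0 < toℕ i → iterate T (toℕ i) x ≢ x
  from h i p = h (toℕ i) p (toℕ<n i)

allVecs : (n : ℕ) → List (Vec Bool n)
allVecs zero = [] ∷ []
allVecs (suc n) = map (false ∷_) (allVecs n) ++ map (true ∷_) (allVecs n)

numPer : ∀ {n} → (Vec Bool n → Vec Bool n) → ℕ → ℕ
numPer {n} T r = length (filter (isPeriodic? T r) (allVecs n))

module Submission where

-- Write m = n - 1 and f_k = c_k + parity₃. Sweeping once around the cycle gives a closed form for T,
-- and in the coordinates s(x) = x₀ + x_m and u_i(x) = x_i + [i odd]·s(x) + D_i (i < m) the map T is an
-- affine shift register: s ↦ s + γ, u_i ↦ u_{i+1} and u_{m-1} ↦ u₀ + τ·s + ε, with γ = Σ c_k, τ = [m-1 odd]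
-- and a constant ε. So an orbit is encoded by s(x) and the sequence w_j = u₀(Tʲ x), which satisfies
-- w_{j+m} = w_j + A(s(x), j), and Tᵈ x = x iff [d odd]·γ = 0 and w is d-periodic. Counting such data gives
-- |Fix(Tᵈ)| = 2^{d/2+1} whenever d is even and 2m/d is odd, and, if T has a fixed point (so γ = 0), also
-- |Fix(Tᵈ)| = 2^{d+1} (n even) or 2^d (n odd) for d ∣ m. Moreover T^{2m} = id, T^m = id in the even case with
-- a fixed point, and T^m has no fixed point at all when T has none. Since |Fix(Tᵈ)| = Σ_{p ∣ d} |Per_p(T)|,
-- Möbius inversion gives the formulas.

open import Data.Bool using (Bool; true; false; if_then_else_; not; _∧_; _xor_)
open import Data.Bool.Properties
  using (xor-∧-commutativeRing; xor-identityʳ; xor-same; xor-assoc; not-distribˡ-xor; not-involutive; ∧-zeroʳ; ∧-identityʳ)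
open import Data.Nat as ℕ using (ℕ; zero; suc; _≤_; _<_; s≤s; z≤n)
import Data.Nat.Properties as ℕP
open import Data.Integer using (+_)
import Data.Integer as ℤ
open import Data.Fin using (Fin; toℕ; fromℕ<)
import Data.Fin as Fin
open import Data.Maybe using (just; nothing)
open import Data.Product using (∃; _×_; _,_; proj₁; proj₂)
open import Data.Sum using (_⊎_; inj₁; inj₂)
open import Relation.Binary.PropositionalEquality
open import Relation.Nullary using (¬_; Dec; does; yes; no; contradiction)
open import Relation.Nullary.Decidable using (dec-true; dec-false)
open import Tactic.RingSolver.Core.AlmostCommutativeRing using (AlmostCommutativeRing; fromCommutativeRing)
open import Tactic.RingSolver using (solve-∀)
open import Defs using (LocalFn; parity₃; oneParity₃; evalFn; prevV; nextV; localUpdate; SDS)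

module Sum where

  open import Data.Integer using (ℤ; -_)
  open import Defs using (sumℤ)
  open import Data.List using (List; []; _∷_; map; filter; length; upTo; applyUpTo)
  open import Relation.Unary using (Decidable)

  open import Data.Integer using (_+_; _*_)
  import Data.Integer.Properties as ℤP
  open import Algebra.Properties.CommutativeSemigroup ℤP.+-commutativeSemigroup using (interchange)

  Σ< : ℕ → (ℕ → ℤ) → ℤ
  Σ< zero    h = + 0
  Σ< (suc N) h = Σ< N h + h N

  ind : Bool → ℤ → ℤ
  ind b v = if b then v else + 0

  Σ<-cong : ∀ N {h h′ : ℕ → ℤ} → (∀ k → k < N → h k ≡ h′ k) → Σ< N h ≡ Σ< N h′
  Σ<-cong zero    eq = refl
  Σ<-cong (suc N) eq = cong₂ _+_ (Σ<-cong N (λ k k<N → eq k (ℕP.m<n⇒m<1+n k<N))) (eq N ℕP.≤-refl)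

  Σ<-zero : ∀ N {h : ℕ → ℤ} → (∀ k → k < N → h k ≡ + 0) → Σ< N h ≡ + 0
  Σ<-zero zero    eq = refl
  Σ<-zero (suc N) eq = cong₂ _+_ (Σ<-zero N (λ k k<N → eq k (ℕP.m<n⇒m<1+n k<N))) (eq N ℕP.≤-refl)

  Σ<-+ : ∀ N (h h′ : ℕ → ℤ) → Σ< N (λ k → h k + h′ k) ≡ Σ< N h + Σ< N h′
  Σ<-+ zero    h h′ = refl
  Σ<-+ (suc N) h h′ rewrite Σ<-+ N h h′ = interchange (Σ< N h) (Σ< N h′) (h N) (h′ N)

  Σ<-*ˡ : ∀ N (a : ℤ) (h : ℕ → ℤ) → Σ< N (λ k → a * h k) ≡ a * Σ< N h
  Σ<-*ˡ zero    a h = sym (ℤP.*-zeroʳ a)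
  Σ<-*ˡ (suc N) a h rewrite Σ<-*ˡ N a h = sym (ℤP.*-distribˡ-+ a (Σ< N h) (h N))

  Σ<-neg : ∀ N (h : ℕ → ℤ) → Σ< N (λ k → - h k) ≡ - Σ< N h
  Σ<-neg zero    h = refl
  Σ<-neg (suc N) h rewrite Σ<-neg N h = sym (ℤP.neg-distrib-+ (Σ< N h) (h N))

  Σ<-suc : ∀ N (h : ℕ → ℤ) → Σ< (suc N) h ≡ h 0 + Σ< N (λ k → h (suc k))
  Σ<-suc zero    h = trans (ℤP.+-identityˡ (h 0)) (sym (ℤP.+-identityʳ (h 0)))
  Σ<-suc (suc N) h rewrite Σ<-suc N h = ℤP.+-assoc (h 0) _ _

  Σ<-extend : ∀ {N N′} {h : ℕ → ℤ} → N ≤ N′ → (∀ k → N ≤ k → h k ≡ + 0) → Σ< N′ h ≡ Σ< N h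
  Σ<-extend {N} {N′} {h} N≤N′ vanish = subst (λ M → Σ< M h ≡ Σ< N h) (ℕP.m∸n+n≡m N≤N′) (go (N′ ℕ.∸ N))
    where
    go : ∀ d → Σ< (d ℕ.+ N) h ≡ Σ< N h
    go zero    = refl
    go (suc d) rewrite go d | vanish (d ℕ.+ N) (ℕP.m≤n+m N d) = ℤP.+-identityʳ _

  Σ<-swap : ∀ N M (h : ℕ → ℕ → ℤ) → Σ< N (λ i → Σ< M (h i)) ≡ Σ< M (λ j → Σ< N (λ i → h i j))
  Σ<-swap zero    M h = sym (Σ<-zero M (λ _ _ → refl))
  Σ<-swap (suc N) M h rewrite Σ<-swap N M h = sym (Σ<-+ M (λ j → Σ< N (λ i → h i j)) (h N))

  ind-yes : ∀ {A : Set} (a? : Dec A) {v : ℤ} → A → ind (does a?) v ≡ v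
  ind-yes a? a rewrite dec-true a? a = refl

  ind-no : ∀ {A : Set} (a? : Dec A) {v : ℤ} → ¬ A → ind (does a?) v ≡ + 0
  ind-no a? ¬a rewrite dec-false a? ¬a = refl

  δ-cong : ∀ {k a} (h : ℕ → ℤ) → ind (does (k ℕ.≟ a)) (h k) ≡ ind (does (k ℕ.≟ a)) (h a)
  δ-cong {k} {a} h with k ℕ.≟ a
  ... | yes refl = refl
  ... | no k≢a   = trans (ind-no (k ℕ.≟ a) k≢a) (sym (ind-no (k ℕ.≟ a) k≢a))

  Σ<-δ : ∀ N {a} (v : ℤ) → a < N → Σ< N (λ k → ind (does (k ℕ.≟ a)) v) ≡ v
  Σ<-δ (suc N) {a} v a<1+N with ℕP.m≤n⇒m<n∨m≡n (ℕP.≤-pred a<1+N)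
  ... | inj₁ a<N rewrite Σ<-δ N v a<N | ind-no (N ℕ.≟ a) {v} (ℕP.>⇒≢ a<N) = ℤP.+-identityʳ v
  ... | inj₂ refl rewrite Σ<-zero a {λ k → ind (does (k ℕ.≟ a)) v} (λ k k<a → ind-no (k ℕ.≟ a) (ℕP.<⇒≢ k<a))
                        | ind-yes (a ℕ.≟ a) {v} refl = ℤP.+-identityˡ v

  true≢false : true ≢ false
  true≢false ()

  ind-*ʳ : ∀ b (a v : ℤ) → ind b (a * v) ≡ a * ind b v
  ind-*ʳ true  a v = refl
  ind-*ʳ false a v = sym (ℤP.*-zeroʳ a)

  module _ {M N : ℕ} {P Q : ℕ → Bool} {φ : ℕ → ℕ}
           (into : ∀ {j} → j < M → Q j ≡ true → φ j < N × P (φ j) ≡ true)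
           (injective : ∀ {j j′} → j < M → j′ < M → Q j ≡ true → Q j′ ≡ true → φ j ≡ φ j′ → j ≡ j′)
           (onto : ∀ {k} → k < N → P k ≡ true → ∃ λ j → j < M × Q j ≡ true × φ j ≡ k)
           where

    private
      fiber : ∀ {k} (v : ℤ) → k < N →
        ind (P k) v ≡ Σ< M (λ j → ind (Q j) (ind (does (k ℕ.≟ φ j)) v))
      fiber {k} v k<N with P k in Pk
      ... | false = sym (Σ<-zero M empty)
        where
        empty : ∀ j → j < M → ind (Q j) (ind (does (k ℕ.≟ φ j)) v) ≡ + 0
        empty j j<M with Q j in Qj
        ... | false = refl
        ... | true  = ind-no (k ℕ.≟ φ j) (λ { refl → true≢false (trans (sym (proj₂ (into j<M Qj))) Pk) })
      ... | true with onto k<N Pk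
      ...   | j₀ , j₀<M , Qj₀ , φj₀≡k = sym (trans (Σ<-cong M single) (Σ<-δ M v j₀<M))
        where
        single : ∀ j → j < M → ind (Q j) (ind (does (k ℕ.≟ φ j)) v) ≡ ind (does (j ℕ.≟ j₀)) v
        single j j<M with Q j in Qj | k ℕ.≟ φ j
        ... | true  | yes k≡φj =
          trans (ind-yes (k ℕ.≟ φ j) k≡φj)
                (sym (ind-yes (j ℕ.≟ j₀) (injective j<M j₀<M Qj Qj₀ (trans (sym k≡φj) (sym φj₀≡k)))))
        ... | true  | no k≢φj = trans (ind-no (k ℕ.≟ φ j) k≢φj) (sym (ind-no (j ℕ.≟ j₀) (λ { refl → k≢φj (sym φj₀≡k) })))
        ... | false | _ = sym (ind-no (j ℕ.≟ j₀) (λ { refl → true≢false (trans (sym Qj₀) Qj) }))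

    Σ<-reindex : (h : ℕ → ℤ) → Σ< N (λ k → ind (P k) (h k)) ≡ Σ< M (λ j → ind (Q j) (h (φ j)))
    Σ<-reindex h = begin
      Σ< N (λ k → ind (P k) (h k))
        ≡⟨ Σ<-cong N (λ k → fiber (h k)) ⟩
      Σ< N (λ k → Σ< M (λ j → ind (Q j) (ind (does (k ℕ.≟ φ j)) (h k))))
        ≡⟨ Σ<-swap N M _ ⟩
      Σ< M (λ j → Σ< N (λ k → ind (Q j) (ind (does (k ℕ.≟ φ j)) (h k))))
        ≡⟨ Σ<-cong M (λ j j<M → collapse j j<M (Q j) refl) ⟩
      Σ< M (λ j → ind (Q j) (h (φ j))) ∎
      where
      open ≡-Reasoning
      collapse : ∀ j → j < M → ∀ b → Q j ≡ b →
        Σ< N (λ k → ind b (ind (does (k ℕ.≟ φ j)) (h k))) ≡ ind b (h (φ j))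
      collapse j j<M false _  = Σ<-zero N (λ _ _ → refl)
      collapse j j<M true  Qj =
        trans (Σ<-cong N (λ k _ → δ-cong h)) (Σ<-δ N (h (φ j)) (proj₁ (into j<M Qj)))

  sumℤ-applyUpTo : ∀ N (g : ℕ → ℕ) (F : ℕ → ℤ) → sumℤ (map F (applyUpTo g N)) ≡ Σ< N (λ k → F (g k))
  sumℤ-applyUpTo zero    g F = refl
  sumℤ-applyUpTo (suc N) g F rewrite sumℤ-applyUpTo N (λ k → g (suc k)) F = sym (Σ<-suc N (λ k → F (g k)))

  sumℤ-upTo : ∀ N (F : ℕ → ℤ) → sumℤ (map F (upTo N)) ≡ Σ< N F
  sumℤ-upTo N = sumℤ-applyUpTo N (λ k → k)

  length-filter : ∀ {A : Set} {P : A → Set} (P? : Decidable P) (xs : List A) →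
    + length (filter P? xs) ≡ sumℤ (map (λ x → ind (does (P? x)) (+ 1)) xs)
  length-filter P? [] = refl
  length-filter P? (x ∷ xs) with does (P? x)
  ... | true  = cong (_+_ (+ 1)) (length-filter P? xs)
  ... | false = trans (length-filter P? xs) (sym (ℤP.+-identityˡ _))

  sumℤ-cong : ∀ {A : Set} (xs : List A) {f g : A → ℤ} → (∀ x → f x ≡ g x) → sumℤ (map f xs) ≡ sumℤ (map g xs)
  sumℤ-cong []       eq = refl
  sumℤ-cong (x ∷ xs) eq = cong₂ _+_ (eq x) (sumℤ-cong xs eq)

  sumℤ-Σ<-comm : ∀ {A : Set} (xs : List A) M (F : A → ℕ → ℤ) →
    sumℤ (map (λ x → Σ< M (F x)) xs) ≡ Σ< M (λ p → sumℤ (map (λ x → F x p) xs))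
  sumℤ-Σ<-comm []       M F = sym (Σ<-zero M (λ _ _ → refl))
  sumℤ-Σ<-comm (x ∷ xs) M F rewrite sumℤ-Σ<-comm xs M F = sym (Σ<-+ M (F x) (λ p → sumℤ (map (λ x → F x p) xs)))

  ind-sumℤ : ∀ {A : Set} b (xs : List A) (h : A → ℤ) → ind b (sumℤ (map h xs)) ≡ sumℤ (map (λ x → ind b (h x)) xs)
  ind-sumℤ true  xs       h = refl
  ind-sumℤ false []       h = refl
  ind-sumℤ false (x ∷ xs) h = trans (ind-sumℤ false xs h) (sym (ℤP.+-identityˡ _))

module Möbius where

  open import Data.Integer using (ℤ; -_)
  open Sum
  open import Defs using (μ)
  open import Data.Nat using (_*_; _/_; >-nonZero)
  open import Data.Nat.DivMod using (m/n≤m; m*n/n≡m; m/n*n≡m)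
  open import Data.Integer using (_+_)
  import Data.Integer.Properties as ℤP
  open import Data.Nat.Divisibility
  open import Data.Nat.Coprimality using (Coprime; coprime-divisor)
  open import Data.Nat.Primality
    using (Prime; prime?; euclidsLemma; prime⇒irreducible; prime⇒nonZero; prime⇒nonTrivial)
  open import Data.List using (List; []; _∷_; filter; upTo; length)
  open import Data.List.Relation.Unary.All using ([]; _∷_)
  open import Data.Nat.ListAction using (product)
  open import Data.Nat.Primality.Factorisation using (factorise)
  open import Data.List.Relation.Unary.Any using (any?)
  open import Data.List.Membership.Propositional using (find; lose)
  open import Data.List.Membership.Propositional.Properties using (∈-filter⁺; ∈-filter⁻; ∈-upTo⁺)
  open import Data.Bool.Properties using (⇔→≡; T-≡)
  open import Function.Bundles using (mk⇔; Equivalence; _⇔_)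
  open import Relation.Nullary.Decidable using (⌊_⌋; _×-dec_; does-⇔; toWitness; isYes≗does)

  Σ∣ : ℕ → (ℕ → ℤ) → ℤ
  Σ∣ r h = Σ< (suc r) (λ d → ind (does (d ∣? r)) (h d))

  divisor-pos : ∀ {d m} → 1 ≤ m → d ∣ m → 1 ≤ d
  divisor-pos {zero}  1≤m 0∣m = contradiction (0∣⇒≡0 0∣m) (ℕP.>⇒≢ 1≤m)
  divisor-pos {suc d} _   _   = s≤s z≤n

  divisor-≤ : ∀ {d m} → 1 ≤ m → d ∣ m → d ≤ m
  divisor-≤ 1≤m = ∣⇒≤ {{>-nonZero 1≤m}}

  prime>1 : ∀ {p} → Prime p → 1 < p
  prime>1 {p} pp = ℕ.nonTrivial⇒n>1 p {{prime⇒nonTrivial pp}}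

  prime∣prime : ∀ {p q} → Prime p → Prime q → q ∣ p → q ≡ p
  prime∣prime pp pq q∣p with prime⇒irreducible pp q∣p
  ... | inj₁ refl = contradiction (prime>1 pq) (ℕP.<-irrefl refl)
  ... | inj₂ q≡p = q≡p

  ¬∣⇒coprime : ∀ {p d} → Prime p → ¬ p ∣ d → Coprime d p
  ¬∣⇒coprime pp p∤d (i∣d , i∣p) with prime⇒irreducible pp i∣p
  ... | inj₁ i≡1 = i≡1
  ... | inj₂ refl = contradiction i∣d p∤d

  prime-divisor : ∀ {m} → 2 ≤ m → ∃ λ p → Prime p × p ∣ m
  prime-divisor {m} 2≤m with factorise m {{>-nonZero (ℕP.<⇒≤ 2≤m)}}
  ... | record { factors = [] ; isFactorisation = m≡1 } = contradiction m≡1 (ℕP.>⇒≢ 2≤m)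
  ... | record { factors = p ∷ ps ; isFactorisation = m≡Π ; factorsPrime = pp ∷ _ } =
    p , pp , subst (p ∣_) (sym m≡Π) (∣m⇒∣m*n (product ps) ∣-refl)

  -- The private auxiliaries of μ in Defs, restated; μ unfolds to them definitionally.
  primeDivisors : ℕ → List ℕ
  primeDivisors n = filter (λ p → prime? p ×-dec (p ∣? n)) (upTo (suc n))

  squareful : ℕ → Bool
  squareful n = ⌊ any? (λ p → p * p ∣? n) (primeDivisors n) ⌋

  squareful⇒ : ∀ {n} → squareful n ≡ true → ∃ λ q → Prime q × q * q ∣ n
  squareful⇒ {n} sq with find (toWitness {a? = any? (λ p → p * p ∣? n) (primeDivisors n)} (Equivalence.from T-≡ sq))
  ... | q , q∈ , qq∣n = q , proj₁ (proj₂ (∈-filter⁻ (λ p → prime? p ×-dec (p ∣? n)) {xs = upTo (suc n)} q∈)) , qq∣n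

  squareful⇐ : ∀ {n q} → 1 ≤ n → Prime q → q * q ∣ n → squareful n ≡ true
  squareful⇐ {n} {q} 1≤n pq qq∣n = trans (isYes≗does _) (dec-true (any? (λ p → p * p ∣? n) (primeDivisors n))
    (lose (∈-filter⁺ (λ p → prime? p ×-dec (p ∣? n)) (∈-upTo⁺ (s≤s (divisor-≤ 1≤n q∣n))) (pq , q∣n)) qq∣n))
    where
    q∣n : q ∣ n
    q∣n = ∣-trans (∣m⇒∣m*n q ∣-refl) qq∣n

  μ-squareful : ∀ {d q} → 1 ≤ d → Prime q → q * q ∣ d → μ d ≡ + 0
  μ-squareful 1≤d pq qq∣d rewrite squareful⇐ 1≤d pq qq∣d = refl

  square∣-cancelˡ : ∀ {p k q} → Prime p → ¬ p ∣ k → Prime q → q * q ∣ p * k → q * q ∣ k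
  square∣-cancelˡ {p} {k} {q} pp p∤k pq qq∣pk with q ℕ.≟ p
  ... | yes refl = contradiction (*-cancelˡ-∣ q {{prime⇒nonZero pq}} qq∣pk) p∤k
  ... | no q≢p   = coprime-divisor (¬∣⇒coprime pp p∤qq) qq∣pk
    where
    p∤qq : ¬ p ∣ q * q
    p∤qq p∣qq with euclidsLemma q q pp p∣qq
    ... | inj₁ p∣q = q≢p (sym (prime∣prime pq pp p∣q))
    ... | inj₂ p∣q = q≢p (sym (prime∣prime pq pp p∣q))

  squareful-*ˡ : ∀ {p k} → Prime p → ¬ p ∣ k → 1 ≤ k → squareful (p * k) ≡ squareful k
  squareful-*ˡ {p} {k} pp p∤k 1≤k = ⇔→≡ (mk⇔ to from)
    where
    to : squareful (p * k) ≡ true → squareful k ≡ true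
    to sq with squareful⇒ sq
    ... | q , pq , qq∣pk = squareful⇐ 1≤k pq (square∣-cancelˡ pp p∤k pq qq∣pk)
    from : squareful k ≡ true → squareful (p * k) ≡ true
    from sq with squareful⇒ sq
    ... | q , pq , qq∣k = squareful⇐ (ℕP.*-mono-≤ (ℕP.<⇒≤ (prime>1 pp)) 1≤k) pq (∣n⇒∣m*n p qq∣k)

  isPrimeDivisor : ℕ → ℕ → Bool
  isPrimeDivisor n q = does (prime? q ×-dec (q ∣? n))

  length-primeDivisors : ∀ n → + length (primeDivisors n) ≡ Σ< (suc n) (λ q → ind (isPrimeDivisor n q) (+ 1))
  length-primeDivisors n = trans (length-filter (λ p → prime? p ×-dec (p ∣? n)) (upTo (suc n))) (sumℤ-upTo (suc n) _)

  prime∣-cancelˡ : ∀ {p q k} → Prime p → Prime q → q ≢ p → q ∣ p * k → q ∣ k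
  prime∣-cancelˡ {p} {q} {k} pp pq q≢p q∣pk with euclidsLemma p k pq q∣pk
  ... | inj₁ q∣p = contradiction (prime∣prime pp pq q∣p) q≢p
  ... | inj₂ q∣k = q∣k

  isPrimeDivisor-*ˡ : ∀ {p k} → Prime p → ¬ p ∣ k → ∀ q →
    ind (isPrimeDivisor (p * k) q) (+ 1) ≡ ind (isPrimeDivisor k q) (+ 1) + ind (does (q ℕ.≟ p)) (+ 1)
  isPrimeDivisor-*ˡ {p} {k} pp p∤k q with prime? q
  ... | no ¬pq = sym (trans (ℤP.+-identityˡ _) (ind-no (q ℕ.≟ p) (λ { refl → ¬pq pp })))
  ... | yes pq with q ℕ.≟ p
  ...   | yes refl rewrite dec-true (q ∣? q * k) (m∣m*n k) | dec-false (q ∣? k) p∤k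
                         | ind-yes (q ℕ.≟ q) {+ 1} refl = refl
  ...   | no q≢p rewrite does-⇔ (mk⇔ (prime∣-cancelˡ pp pq q≢p) (∣n⇒∣m*n p)) (q ∣? p * k) (q ∣? k)
                       | ind-no (q ℕ.≟ p) {+ 1} q≢p = sym (ℤP.+-identityʳ _)

  #primeDivisors-*ˡ : ∀ {p k} → Prime p → ¬ p ∣ k → 1 ≤ k →
    length (primeDivisors (p * k)) ≡ suc (length (primeDivisors k))
  #primeDivisors-*ˡ {p} {k} pp p∤k 1≤k = ℤP.+-injective (begin
    + length (primeDivisors (p * k))
      ≡⟨ length-primeDivisors (p * k) ⟩
    Σ< (suc (p * k)) (λ q → ind (isPrimeDivisor (p * k) q) (+ 1))
      ≡⟨ Σ<-cong (suc (p * k)) (λ q _ → isPrimeDivisor-*ˡ pp p∤k q) ⟩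
    Σ< (suc (p * k)) (λ q → ind (isPrimeDivisor k q) (+ 1) + ind (does (q ℕ.≟ p)) (+ 1))
      ≡⟨ Σ<-+ (suc (p * k)) _ _ ⟩
    Σ< (suc (p * k)) (λ q → ind (isPrimeDivisor k q) (+ 1)) + Σ< (suc (p * k)) (λ q → ind (does (q ℕ.≟ p)) (+ 1))
      ≡⟨ cong₂ _+_ (Σ<-extend (s≤s k≤pk) beyond-k) (Σ<-δ (suc (p * k)) (+ 1) (s≤s p≤pk)) ⟩
    Σ< (suc k) (λ q → ind (isPrimeDivisor k q) (+ 1)) + + 1
      ≡⟨ cong (_+ + 1) (sym (length-primeDivisors k)) ⟩
    + length (primeDivisors k) + + 1
      ≡⟨ ℤP.+-comm (+ length (primeDivisors k)) (+ 1) ⟩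
    + suc (length (primeDivisors k)) ∎)
    where
    open ≡-Reasoning
    k≤pk : k ≤ p * k
    k≤pk = ℕP.m≤n*m k p {{prime⇒nonZero pp}}
    p≤pk : p ≤ p * k
    p≤pk = ℕP.m≤m*n p k {{>-nonZero 1≤k}}
    beyond-k : ∀ q → suc k ≤ q → ind (isPrimeDivisor k q) (+ 1) ≡ + 0
    beyond-k q k<q rewrite dec-false (q ∣? k) (λ q∣k → ℕP.<⇒≱ k<q (divisor-≤ 1≤k q∣k)) | ∧-zeroʳ (does (prime? q)) = refl

  μ-*ˡ : ∀ {p k} → Prime p → ¬ p ∣ k → 1 ≤ k → μ (p * k) ≡ - μ k
  μ-*ˡ {p} {k} pp p∤k 1≤k rewrite squareful-*ˡ pp p∤k 1≤k | #primeDivisors-*ˡ pp p∤k 1≤k with squareful k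
  ... | true  = refl
  ... | false = refl

  ind-∣-beyond : ∀ {d r} (v : ℤ) → 1 ≤ r → r < d → ind (does (d ∣? r)) v ≡ + 0
  ind-∣-beyond {d} {r} v 1≤r r<d rewrite dec-false (d ∣? r) (λ d∣r → ℕP.<⇒≱ r<d (divisor-≤ 1≤r d∣r)) = refl

  Σ∣-extend : ∀ {r N} (h : ℕ → ℤ) → 1 ≤ r → r ≤ N → Σ< (suc N) (λ d → ind (does (d ∣? r)) (h d)) ≡ Σ∣ r h
  Σ∣-extend h 1≤r r≤N = Σ<-extend (s≤s r≤N) (λ d r<d → ind-∣-beyond (h d) 1≤r r<d)

  -- The divisors d of p * k with p ∤ d are the divisors of k coprime to p, those with p ∥ d are p times
  -- such divisors and contribute the opposite value of μ, and μ vanishes on the rest.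
  module _ {p k} (pp : Prime p) (1≤k : 1 ≤ k) where

    private
      p≢0 = prime⇒nonZero pp
      n = p * k

      1≤n : 1 ≤ n
      1≤n = ℕP.*-mono-≤ (ℕP.<⇒≤ (prime>1 pp)) 1≤k

      coprimeDivisor exactDivisor : ℕ → Bool
      coprimeDivisor d = does (d ∣? k) ∧ not (does (p ∣? d))
      exactDivisor   d = does (d ∣? n) ∧ (does (p ∣? d) ∧ not (does (p * p ∣? d)))

      split : ∀ d → ind (does (d ∣? n)) (μ d) ≡ ind (coprimeDivisor d) (μ d) + ind (exactDivisor d) (μ d)
      split d with p ∣? d | d ∣? n
      ... | no p∤d | yes d∣n rewrite dec-true (d ∣? k) (coprime-divisor (¬∣⇒coprime pp p∤d) d∣n) =
        sym (ℤP.+-identityʳ (μ d))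
      ... | no p∤d | no d∤n rewrite dec-false (d ∣? k) (λ d∣k → d∤n (∣n⇒∣m*n p d∣k)) = refl
      ... | yes p∣d | no d∤n rewrite ∧-zeroʳ (does (d ∣? k)) = refl
      ... | yes p∣d | yes d∣n rewrite ∧-zeroʳ (does (d ∣? k)) with p * p ∣? d
      ...   | yes pp∣d = μ-squareful (divisor-pos 1≤n d∣n) pp pp∣d
      ...   | no _     = sym (ℤP.+-identityˡ (μ d))

      coprime-beyond : ∀ d → suc k ≤ d → ind (coprimeDivisor d) (μ d) ≡ + 0
      coprime-beyond d k<d rewrite dec-false (d ∣? k) (λ d∣k → ℕP.<⇒≱ k<d (divisor-≤ 1≤k d∣k)) = refl

      exactDivisor-intro : ∀ {d} → d ∣ k → ¬ p ∣ d → exactDivisor (p * d) ≡ true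
      exactDivisor-intro {d} d∣k p∤d
        rewrite dec-true (p * d ∣? n) (*-monoʳ-∣ p d∣k) | dec-true (p ∣? p * d) (m∣m*n d)
              | dec-false (p * p ∣? p * d) (λ pp∣pd → p∤d (*-cancelˡ-∣ p {{p≢0}} pp∣pd)) = refl

      coprimeDivisor-intro : ∀ {d} → d ∣ k → ¬ p ∣ d → coprimeDivisor d ≡ true
      coprimeDivisor-intro {d} d∣k p∤d rewrite dec-true (d ∣? k) d∣k | dec-false (p ∣? d) p∤d = refl

      into : ∀ {d} → d < suc k → coprimeDivisor d ≡ true → p * d < suc n × exactDivisor (p * d) ≡ true
      into {d} _ with d ∣? k | p ∣? d
      ... | yes d∣k | no p∤d = λ _ → s≤s (ℕP.*-monoʳ-≤ p (divisor-≤ 1≤k d∣k)) , exactDivisor-intro d∣k p∤d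
      ... | yes _   | yes _  = λ ()
      ... | no _    | _      = λ ()

      injective : ∀ {d d′} → d < suc k → d′ < suc k → coprimeDivisor d ≡ true → coprimeDivisor d′ ≡ true →
        p * d ≡ p * d′ → d ≡ d′
      injective {d} {d′} _ _ _ _ = ℕP.*-cancelˡ-≡ d d′ p {{p≢0}}

      onto : ∀ {e} → e < suc n → exactDivisor e ≡ true → ∃ λ d → d < suc k × coprimeDivisor d ≡ true × p * d ≡ e
      onto {e} _ with e ∣? n | p ∣? e | p * p ∣? e
      ... | yes e∣n | yes (divides d refl) | no pp∤e =
        λ _ → d , s≤s (divisor-≤ 1≤k d∣k) , coprimeDivisor-intro d∣k p∤d , ℕP.*-comm p d
        where
        d∣k : d ∣ k
        d∣k = *-cancelˡ-∣ p {{p≢0}} (subst (_∣ n) (ℕP.*-comm d p) e∣n)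
        p∤d : ¬ p ∣ d
        p∤d p∣d = pp∤e (subst (p * p ∣_) (ℕP.*-comm p d) (*-monoʳ-∣ p p∣d))
      ... | yes _ | yes _ | yes _ = λ ()
      ... | yes _ | no _  | _     = λ ()
      ... | no _  | _     | _     = λ ()

      μ-exact : ∀ d → ind (coprimeDivisor d) (μ (p * d)) ≡ - ind (coprimeDivisor d) (μ d)
      μ-exact d with d ∣? k | p ∣? d
      ... | yes d∣k | no p∤d = μ-*ˡ pp p∤d (divisor-pos 1≤k d∣k)
      ... | yes _   | yes _  = refl
      ... | no _    | _      = refl

    Σ∣μ-*ˡ : Σ∣ (p * k) μ ≡ + 0
    Σ∣μ-*ˡ = begin
      Σ< (suc n) (λ d → ind (does (d ∣? n)) (μ d))
        ≡⟨ Σ<-cong (suc n) (λ d _ → split d) ⟩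
      Σ< (suc n) (λ d → C d + ind (exactDivisor d) (μ d))
        ≡⟨ Σ<-+ (suc n) C _ ⟩
      Σ< (suc n) C + Σ< (suc n) (λ d → ind (exactDivisor d) (μ d))
        ≡⟨ cong₂ _+_ (Σ<-extend (s≤s (ℕP.m≤n*m k p {{p≢0}})) coprime-beyond) (Σ<-reindex into injective onto μ) ⟩
      Σ< (suc k) C + Σ< (suc k) (λ d → ind (coprimeDivisor d) (μ (p * d)))
        ≡⟨ cong (_+_ (Σ< (suc k) C)) (trans (Σ<-cong (suc k) (λ d _ → μ-exact d)) (Σ<-neg (suc k) C)) ⟩
      Σ< (suc k) C - Σ< (suc k) C
        ≡⟨ ℤP.+-inverseʳ (Σ< (suc k) C) ⟩
      + 0 ∎
      where
      open ≡-Reasoning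
      open import Data.Integer using (_-_)
      C : ℕ → ℤ
      C d = ind (coprimeDivisor d) (μ d)

  Σ∣μ : ∀ {m} → 1 ≤ m → Σ∣ m μ ≡ ind (does (m ℕ.≟ 1)) (+ 1)
  Σ∣μ {suc zero}    _ = refl
  Σ∣μ {suc (suc k)} _ with prime-divisor {suc (suc k)} (s≤s (s≤s z≤n))
  ... | p , pp , divides q m≡qp =
    trans (cong (λ m → Σ∣ m μ) (trans m≡qp (ℕP.*-comm q p))) (Σ∣μ-*ˡ pp (cofactor-pos q m≡qp))
    where
    cofactor-pos : ∀ q → suc (suc k) ≡ q * p → 1 ≤ q
    cofactor-pos (suc q) _ = s≤s z≤n

  -- r / d with the junk value 0 at d = 0, so that no NonZero instance is needed.
  quot : ℕ → ℕ → ℕ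
  quot r zero    = 0
  quot r (suc d) = r / suc d

  quot-≤ : ∀ r d → quot r d ≤ r
  quot-≤ r zero    = z≤n
  quot-≤ r (suc d) = m/n≤m r (suc d)

  quot-*ˡ : ∀ a {d} → 1 ≤ d → quot (a * d) d ≡ a
  quot-*ˡ a {suc d} _ = m*n/n≡m a (suc d)

  quot-* : ∀ {r d} → 1 ≤ d → d ∣ r → quot r d * d ≡ r
  quot-* {d = suc d} _ d∣r = m/n*n≡m d∣r

  quot-∣ : ∀ {r d} → 1 ≤ r → d ∣ r → quot r d ∣ r
  quot-∣ {r} {d} 1≤r d∣r = divides d (trans (sym (quot-* (divisor-pos 1≤r d∣r) d∣r)) (ℕP.*-comm (quot r d) d))

  quot-pos : ∀ {r d} → 1 ≤ r → d ∣ r → 1 ≤ quot r d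
  quot-pos 1≤r d∣r = divisor-pos 1≤r (quot-∣ 1≤r d∣r)

  quot-involutive : ∀ {r d} → 1 ≤ r → d ∣ r → quot r (quot r d) ≡ d
  quot-involutive {r} {d} 1≤r d∣r = begin
    quot r (quot r d)           ≡⟨ cong (λ r′ → quot r′ (quot r d)) (sym (quot-* (divisor-pos 1≤r d∣r) d∣r)) ⟩
    quot (quot r d * d) (quot r d) ≡⟨ cong (λ r′ → quot r′ (quot r d)) (ℕP.*-comm (quot r d) d) ⟩
    quot (d * quot r d) (quot r d) ≡⟨ quot-*ˡ d (quot-pos 1≤r d∣r) ⟩
    d ∎
    where open ≡-Reasoning

  quot≡1⇔ : ∀ {r e} → 1 ≤ r → e ∣ r → quot r e ≡ 1 ⇔ e ≡ r
  quot≡1⇔ {r} {e} 1≤r e∣r = mk⇔ to from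
    where
    to : quot r e ≡ 1 → e ≡ r
    to r/e≡1 = trans (sym (ℕP.*-identityˡ e)) (trans (cong (_* e) (sym r/e≡1)) (quot-* (divisor-pos 1≤r e∣r) e∣r))
    from : e ≡ r → quot r e ≡ 1
    from refl = trans (cong (λ r′ → quot r′ r) (sym (ℕP.*-identityˡ r))) (quot-*ˡ 1 1≤r)

  ∣-quot-swap : ∀ {r d e} → 1 ≤ r → d ∣ r → e ∣ quot r d → e ∣ r × d ∣ quot r e
  ∣-quot-swap {r} {d} {e} 1≤r d∣r (divides t r/d≡te) = divides (t * d) r≡tde , subst (d ∣_) (sym r/e≡td) (n∣m*n t)
    where
    r≡tde : r ≡ t * d * e
    r≡tde = begin
      r                 ≡⟨ sym (quot-* (divisor-pos 1≤r d∣r) d∣r) ⟩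
      quot r d * d      ≡⟨ cong (_* d) r/d≡te ⟩
      t * e * d         ≡⟨ ℕP.*-assoc t e d ⟩
      t * (e * d)       ≡⟨ cong (t *_) (ℕP.*-comm e d) ⟩
      t * (d * e)       ≡⟨ ℕP.*-assoc t d e ⟨
      t * d * e         ∎
      where open ≡-Reasoning
    r/e≡td : quot r e ≡ t * d
    r/e≡td = trans (cong (λ r′ → quot r′ e) r≡tde)
                   (quot-*ˡ (t * d) (divisor-pos (quot-pos 1≤r d∣r) (divides t r/d≡te)))

module MöbiusInversion where

  open import Data.Integer using (ℤ)
  open Sum
  open Möbius
  open import Defs using (μ; divSum; oddDivSum; _∣ₒ_; ∣ₒ?)
  open import Data.Nat using (_/_)
  open import Data.Integer using (_+_; _*_)
  import Data.Integer.Properties as ℤP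
  open import Data.Nat.Divisibility using (_∣_; _∣?_; ∣-refl; divides; 0∣⇒≡0)
  open import Relation.Nullary.Decidable using (⌊_⌋; _×-dec_; does-⇔)
  open import Function.Bundles using (mk⇔)

  Σ∣-cong : ∀ r {h h′ : ℕ → ℤ} → (∀ d → d ∣ r → h d ≡ h′ d) → Σ∣ r h ≡ Σ∣ r h′
  Σ∣-cong r {h} {h′} eq = Σ<-cong (suc r) pointwise
    where
    pointwise : ∀ d → d < suc r → ind (does (d ∣? r)) (h d) ≡ ind (does (d ∣? r)) (h′ d)
    pointwise d _ with d ∣? r
    ... | yes d∣r = eq d d∣r
    ... | no _    = refl

  Σ∣-*ˡ : ∀ r (a : ℤ) (h : ℕ → ℤ) → Σ∣ r (λ d → a * h d) ≡ a * Σ∣ r h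
  Σ∣-*ˡ r a h = trans (Σ<-cong (suc r) (λ d _ → ind-*ʳ (does (d ∣? r)) a (h d))) (Σ<-*ˡ (suc r) a _)

  Σ∣-involution : ∀ {r} → 1 ≤ r → (h : ℕ → ℤ) → Σ∣ r h ≡ Σ∣ r (λ d → h (quot r d))
  Σ∣-involution {r} 1≤r = Σ<-reindex into injective onto
    where
    into : ∀ {d} → d < suc r → does (d ∣? r) ≡ true → quot r d < suc r × does (quot r d ∣? r) ≡ true
    into {d} _ d∣r? with d ∣? r
    ... | yes d∣r = s≤s (quot-≤ r d) , dec-true (quot r d ∣? r) (quot-∣ 1≤r d∣r)
    injective : ∀ {d d′} → d < suc r → d′ < suc r → does (d ∣? r) ≡ true → does (d′ ∣? r) ≡ true →
      quot r d ≡ quot r d′ → d ≡ d′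
    injective {d} {d′} _ _ _ _ _ with d ∣? r | d′ ∣? r
    injective _ _ _ _ eq | yes d∣r | yes d′∣r =
      trans (sym (quot-involutive 1≤r d∣r)) (trans (cong (quot r) eq) (quot-involutive 1≤r d′∣r))
    onto : ∀ {d} → d < suc r → does (d ∣? r) ≡ true → ∃ λ d′ → d′ < suc r × does (d′ ∣? r) ≡ true × quot r d′ ≡ d
    onto {d} _ _ with d ∣? r
    ... | yes d∣r = quot r d , s≤s (quot-≤ r d) , dec-true (quot r d ∣? r) (quot-∣ 1≤r d∣r) , quot-involutive 1≤r d∣r

  module _ {r} (1≤r : 1 ≤ r) where

    private
      expand : ∀ (F : ℕ → ℕ → ℤ) d →
        ind (does (d ∣? r)) (Σ∣ (quot r d) (F d)) ≡ Σ< (suc r) (λ e → ind (does (d ∣? r ×-dec e ∣? quot r d)) (F d e))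
      expand F d with d ∣? r
      ... | yes d∣r = sym (Σ∣-extend (F d) (quot-pos 1≤r d∣r) (quot-≤ r d))
      ... | no _    = sym (Σ<-zero (suc r) (λ _ _ → refl))

      divisor-pair : ∀ d e → does (d ∣? r ×-dec e ∣? quot r d) ≡ does (e ∣? r ×-dec d ∣? quot r e)
      divisor-pair d e = does-⇔ (mk⇔ (λ (d∣r , e∣r/d) → ∣-quot-swap 1≤r d∣r e∣r/d)
                                     (λ (e∣r , d∣r/e) → ∣-quot-swap 1≤r e∣r d∣r/e))
                            (d ∣? r ×-dec e ∣? quot r d) (e ∣? r ×-dec d ∣? quot r e)

    Σ∣-Σ∣-comm : (F : ℕ → ℕ → ℤ) →
      Σ∣ r (λ d → Σ∣ (quot r d) (F d)) ≡ Σ∣ r (λ e → Σ∣ (quot r e) (λ d → F d e))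
    Σ∣-Σ∣-comm F = begin
      Σ∣ r (λ d → Σ∣ (quot r d) (F d))
        ≡⟨ Σ<-cong (suc r) (λ d _ → expand F d) ⟩
      Σ< (suc r) (λ d → Σ< (suc r) (λ e → ind (does (d ∣? r ×-dec e ∣? quot r d)) (F d e)))
        ≡⟨ Σ<-swap (suc r) (suc r) _ ⟩
      Σ< (suc r) (λ e → Σ< (suc r) (λ d → ind (does (d ∣? r ×-dec e ∣? quot r d)) (F d e)))
        ≡⟨ Σ<-cong (suc r) (λ e _ → Σ<-cong (suc r) (λ d _ → cong (λ b → ind b (F d e)) (divisor-pair d e))) ⟩
      Σ< (suc r) (λ e → Σ< (suc r) (λ d → ind (does (e ∣? r ×-dec d ∣? quot r e)) (F d e)))
        ≡⟨ Σ<-cong (suc r) (λ e _ → expand (λ e d → F d e) e) ⟨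
      Σ∣ r (λ e → Σ∣ (quot r e) (λ d → F d e)) ∎
      where open ≡-Reasoning

    Σ∣-quot≡1 : (g : ℕ → ℤ) → Σ∣ r (λ e → g e * ind (does (quot r e ℕ.≟ 1)) (+ 1)) ≡ g r
    Σ∣-quot≡1 g = trans (Σ<-cong (suc r) (λ e _ → pointwise e)) (Σ<-δ (suc r) (g r) ℕP.≤-refl)
      where
      pointwise : ∀ e → ind (does (e ∣? r)) (g e * ind (does (quot r e ℕ.≟ 1)) (+ 1)) ≡ ind (does (e ℕ.≟ r)) (g r)
      pointwise e with e ∣? r
      ... | no e∤r = sym (ind-no (e ℕ.≟ r) (λ { refl → e∤r ∣-refl }))
      ... | yes e∣r = begin
        g e * ind (does (quot r e ℕ.≟ 1)) (+ 1)   ≡⟨ ind-*ʳ _ (g e) (+ 1) ⟨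
        ind (does (quot r e ℕ.≟ 1)) (g e * + 1)
          ≡⟨ cong₂ ind (does-⇔ (quot≡1⇔ 1≤r e∣r) (quot r e ℕ.≟ 1) (e ℕ.≟ r)) (ℤP.*-identityʳ (g e)) ⟩
        ind (does (e ℕ.≟ r)) (g e)               ≡⟨ δ-cong g ⟩
        ind (does (e ℕ.≟ r)) (g r)               ∎
        where open ≡-Reasoning

    möbius-inversion : (g : ℕ → ℤ) → Σ∣ r (λ d → μ (quot r d) * Σ∣ d g) ≡ g r
    möbius-inversion g = begin
      Σ∣ r (λ d → μ (quot r d) * Σ∣ d g)
        ≡⟨ Σ∣-involution 1≤r _ ⟩
      Σ∣ r (λ d → μ (quot r (quot r d)) * Σ∣ (quot r d) g)
        ≡⟨ Σ∣-cong r (λ d d∣r → cong (λ d′ → μ d′ * Σ∣ (quot r d) g) (quot-involutive 1≤r d∣r)) ⟩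
      Σ∣ r (λ d → μ d * Σ∣ (quot r d) g)
        ≡⟨ Σ∣-cong r (λ d _ → Σ∣-*ˡ (quot r d) (μ d) g) ⟨
      Σ∣ r (λ d → Σ∣ (quot r d) (λ e → μ d * g e))
        ≡⟨ Σ∣-Σ∣-comm (λ d e → μ d * g e) ⟩
      Σ∣ r (λ e → Σ∣ (quot r e) (λ d → μ d * g e))
        ≡⟨ Σ∣-cong r (λ e _ → trans (Σ∣-cong (quot r e) (λ d _ → ℤP.*-comm (μ d) (g e))) (Σ∣-*ˡ (quot r e) (g e) μ)) ⟩
      Σ∣ r (λ e → g e * Σ∣ (quot r e) μ)
        ≡⟨ Σ∣-cong r (λ e e∣r → cong (g e *_) (Σ∣μ (quot-pos 1≤r e∣r))) ⟩
      Σ∣ r (λ e → g e * ind (does (quot r e ℕ.≟ 1)) (+ 1))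
        ≡⟨ Σ∣-quot≡1 g ⟩
      g r ∎
      where open ≡-Reasoning

  Σ∣-positive : ∀ {r} → 1 ≤ r → (h : ℕ → ℤ) → Σ∣ r h ≡ Σ< r (λ k → ind (does (suc k ∣? r)) (h (suc k)))
  Σ∣-positive {suc r} _ h =
    trans (Σ<-suc (suc r) _) (trans (cong (_+ rest) (ind-no (0 ∣? suc r) {h 0} 0∤1+r)) (ℤP.+-identityˡ rest))
    where
    rest = Σ< (suc r) (λ k → ind (does (suc k ∣? suc r)) (h (suc k)))
    0∤1+r : ¬ 0 ∣ suc r
    0∤1+r 0∣1+r = contradiction (0∣⇒≡0 0∣1+r) (λ ())

  divSum-inversion : ∀ {r} → 1 ≤ r → (F g : ℕ → ℤ) → (∀ d → d ∣ r → 1 ≤ d → Σ∣ d g ≡ F d) →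
    divSum r (λ d q → μ q * F d) ≡ g r
  divSum-inversion {r} 1≤r F g Σ∣g≡F = begin
    divSum r (λ d q → μ q * F d)
      ≡⟨ sumℤ-upTo r _ ⟩
    Σ< r (λ k → if ⌊ suc k ∣? r ⌋ then μ (r / suc k) * F (suc k) else + 0)
      ≡⟨ Σ<-cong r (λ k _ → pointwise k (suc k ∣? r)) ⟩
    Σ< r (λ k → ind (does (suc k ∣? r)) (μ (quot r (suc k)) * Σ∣ (suc k) g))
      ≡⟨ Σ∣-positive 1≤r _ ⟨
    Σ∣ r (λ d → μ (quot r d) * Σ∣ d g)
      ≡⟨ möbius-inversion 1≤r g ⟩
    g r ∎
    where
    open ≡-Reasoning
    pointwise : ∀ k (d? : Dec (suc k ∣ r)) → (if ⌊ d? ⌋ then μ (r / suc k) * F (suc k) else + 0)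
                                           ≡ ind (does d?) (μ (r / suc k) * Σ∣ (suc k) g)
    pointwise k (yes d∣r) = cong (μ (r / suc k) *_) (sym (Σ∣g≡F (suc k) d∣r (s≤s z≤n)))
    pointwise k (no _)    = refl

  oddDivSum-inversion : ∀ {r} → 1 ≤ r → (F g : ℕ → ℤ) →
    (∀ d → d ∣ₒ r → 1 ≤ d → Σ∣ d g ≡ F d) → (∀ d → d ∣ r → ¬ d ∣ₒ r → 1 ≤ d → Σ∣ d g ≡ + 0) →
    oddDivSum r (λ d q → μ q * F d) ≡ g r
  oddDivSum-inversion {r} 1≤r F g Σ∣g≡F Σ∣g≡0 = begin
    oddDivSum r (λ d q → μ q * F d)
      ≡⟨ sumℤ-upTo r _ ⟩
    Σ< r (λ k → if ⌊ ∣ₒ? k r ⌋ then μ (r / suc k) * F (suc k) else + 0)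
      ≡⟨ Σ<-cong r (λ k _ → pointwise k (∣ₒ? k r) (suc k ∣? r)) ⟩
    Σ< r (λ k → ind (does (suc k ∣? r)) (μ (quot r (suc k)) * Σ∣ (suc k) g))
      ≡⟨ Σ∣-positive 1≤r _ ⟨
    Σ∣ r (λ d → μ (quot r d) * Σ∣ d g)
      ≡⟨ möbius-inversion 1≤r g ⟩
    g r ∎
    where
    open ≡-Reasoning
    pointwise : ∀ k (o? : Dec (suc k ∣ₒ r)) (d? : Dec (suc k ∣ r)) →
      (if ⌊ o? ⌋ then μ (r / suc k) * F (suc k) else + 0) ≡ ind (does d?) (μ (r / suc k) * Σ∣ (suc k) g)
    pointwise k (yes o) (yes _) = cong (μ (r / suc k) *_) (sym (Σ∣g≡F (suc k) o (s≤s z≤n)))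
    pointwise k (yes (q , r≡qd , _)) (no d∤r) = contradiction (divides q r≡qd) d∤r
    pointwise k (no ¬o) (yes d∣r) =
      sym (trans (cong (μ (r / suc k) *_) (Σ∣g≡0 (suc k) d∣r ¬o (s≤s z≤n))) (ℤP.*-zeroʳ (μ (r / suc k))))
    pointwise k (no _) (no _) = refl

module PeriodicPoints where

  open Sum
  open Möbius using (Σ∣; divisor-pos; divisor-≤)
  open import Defs using (iterate; IsPeriodic; isPeriodic?; allVecs; numPer; sumℤ)
  open import Data.Nat using (_+_; _*_; _%_; _/_; >-nonZero)
  open import Data.Nat.DivMod using (m≡m%n+[m/n]*n; m%n<n)
  open import Data.Nat.Divisibility using (_∣_; _∣?_; divides; m%n≡0⇒n∣m)
  open import Data.Vec using (Vec)
  open import Data.Vec.Properties using (≡-dec)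
  import Data.Bool.Properties as 𝔹P
  open import Data.List using (map; filter; length)
  open import Relation.Binary.Definitions using (tri<; tri≈; tri>)

  iterate-+ : ∀ {A : Set} (g : A → A) a b x → iterate g (a + b) x ≡ iterate g a (iterate g b x)
  iterate-+ g zero    b x = refl
  iterate-+ g (suc a) b x = cong g (iterate-+ g a b x)

  iterate-* : ∀ {A : Set} (g : A → A) {p x} → iterate g p x ≡ x → ∀ q → iterate g (q * p) x ≡ x
  iterate-* g         gᵖx≡x zero    = refl
  iterate-* g {p} {x} gᵖx≡x (suc q) =
    trans (iterate-+ g p (q * p) x) (trans (cong (iterate g p) (iterate-* g gᵖx≡x q)) gᵖx≡x)

  module _ {n} (T : Vec Bool n → Vec Bool n) where

    fixed? : ∀ N x → Dec (iterate T N x ≡ x)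
    fixed? N x = ≡-dec 𝔹P._≟_ (iterate T N x) x

    #Fix : ℕ → ℕ
    #Fix N = length (filter (fixed? N) (allVecs n))

    period-unique : ∀ {p q x} → 1 ≤ p → 1 ≤ q → IsPeriodic T p x → IsPeriodic T q x → p ≡ q
    period-unique {p} {q} 1≤p 1≤q (Tᵖx≡x , p-least) (Tᵠx≡x , q-least) with ℕP.<-cmp p q
    ... | tri< p<q _ _ = contradiction Tᵖx≡x (q-least p 1≤p p<q)
    ... | tri≈ _ p≡q _ = p≡q
    ... | tri> _ _ q<p = contradiction Tᵠx≡x (p-least q 1≤q q<p)

    period-∣ : ∀ {p N x} → 1 ≤ p → IsPeriodic T p x → iterate T N x ≡ x → p ∣ N
    period-∣ {p} {N} {x} 1≤p (Tᵖx≡x , p-least) Tᴺx≡x = m%n≡0⇒n∣m N p remainder≡0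
      where
      instance _ = >-nonZero 1≤p
      Tᴺ≡Tʳ : iterate T N x ≡ iterate T (N % p) x
      Tᴺ≡Tʳ = trans (cong (λ k → iterate T k x) (m≡m%n+[m/n]*n N p))
                    (trans (iterate-+ T (N % p) (N / p * p) x) (cong (iterate T (N % p)) (iterate-* T Tᵖx≡x (N / p))))
      remainder≡0 : N % p ≡ 0
      remainder≡0 with N % p | m%n<n N p | Tᴺ≡Tʳ
      ... | zero  | _   | _ = refl
      ... | suc r | r<p | eq = contradiction (trans (sym eq) Tᴺx≡x) (p-least (suc r) (s≤s z≤n) r<p)

    search : ∀ x j → (∃ λ p → 1 ≤ p × IsPeriodic T p x) ⊎ (∀ s → 0 < s → s ≤ j → iterate T s x ≢ x)
    search x zero = inj₂ (λ s 0<s s≤0 → contradiction (ℕP.<-≤-trans 0<s s≤0) (λ ()))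
    search x (suc j) with search x j
    ... | inj₁ found = inj₁ found
    ... | inj₂ none with fixed? (suc j) x
    ...   | yes Tʲ⁺¹x≡x = inj₁ (suc j , s≤s z≤n , Tʲ⁺¹x≡x , λ s 0<s s<1+j → none s 0<s (ℕP.≤-pred s<1+j))
    ...   | no Tʲ⁺¹x≢x = inj₂ λ s 0<s s≤1+j → case ℕP.m≤n⇒m<n∨m≡n s≤1+j of λ where
              (inj₁ s<1+j) → none s 0<s (ℕP.≤-pred s<1+j)
              (inj₂ refl)  → Tʲ⁺¹x≢x
      where open import Function using (case_of_)

    least-period : ∀ {N x} → 1 ≤ N → iterate T N x ≡ x → ∃ λ p → 1 ≤ p × p ∣ N × IsPeriodic T p x
    least-period {N} {x} 1≤N Tᴺx≡x with search x N
    ... | inj₁ (p , 1≤p , per) = p , 1≤p , period-∣ 1≤p per Tᴺx≡x , per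
    ... | inj₂ none = contradiction Tᴺx≡x (none N 1≤N ℕP.≤-refl)

    fixed-indicator : ∀ {N} → 1 ≤ N → ∀ x →
      ind (does (fixed? N x)) (+ 1) ≡ Σ∣ N (λ p → ind (does (isPeriodic? T p x)) (+ 1))
    fixed-indicator {N} 1≤N x = indicator (fixed? N x)
      where
      none : iterate T N x ≢ x → ∀ p → p < suc N → ind (does (p ∣? N)) (ind (does (isPeriodic? T p x)) (+ 1)) ≡ + 0
      none Tᴺx≢x p _ with p ∣? N
      ... | yes (divides q N≡qp) =
        ind-no (isPeriodic? T p x) (λ (Tᵖx≡x , _) → Tᴺx≢x (subst (λ k → iterate T k x ≡ x) (sym N≡qp) (iterate-* T Tᵖx≡x q)))
      ... | no _ = refl
      only : ∀ {p} → 1 ≤ p → p ∣ N → IsPeriodic T p x → ∀ p′ →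
        ind (does (p′ ∣? N)) (ind (does (isPeriodic? T p′ x)) (+ 1)) ≡ ind (does (p′ ℕ.≟ p)) (+ 1)
      only {p} 1≤p p∣N per p′ with p′ ∣? N
      ... | no p′∤N = sym (ind-no (p′ ℕ.≟ p) (λ { refl → p′∤N p∣N }))
      ... | yes p′∣N with isPeriodic? T p′ x
      ...   | yes per′ = trans (ind-yes (isPeriodic? T p′ x) per′)
                               (sym (ind-yes (p′ ℕ.≟ p) (period-unique (divisor-pos 1≤N p′∣N) 1≤p per′ per)))
      ...   | no ¬per′ = trans (ind-no (isPeriodic? T p′ x) ¬per′) (sym (ind-no (p′ ℕ.≟ p) (λ { refl → ¬per′ per })))
      indicator : (d : Dec (iterate T N x ≡ x)) → ind (does d) (+ 1) ≡ Σ∣ N (λ p → ind (does (isPeriodic? T p x)) (+ 1))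
      indicator (no Tᴺx≢x) = sym (Σ<-zero (suc N) (none Tᴺx≢x))
      indicator (yes Tᴺx≡x) with least-period 1≤N Tᴺx≡x
      ... | p , 1≤p , p∣N , per =
        sym (trans (Σ<-cong (suc N) (λ p′ _ → only 1≤p p∣N per p′)) (Σ<-δ (suc N) (+ 1) (s≤s (divisor-≤ 1≤N p∣N))))

    #Fix≡Σ∣numPer : ∀ {N} → 1 ≤ N → + #Fix N ≡ Σ∣ N (λ p → + numPer T p)
    #Fix≡Σ∣numPer {N} 1≤N = begin
      + #Fix N
        ≡⟨ length-filter (fixed? N) xs ⟩
      sumℤ (map (λ x → ind (does (fixed? N x)) (+ 1)) xs)
        ≡⟨ sumℤ-cong xs (fixed-indicator 1≤N) ⟩
      sumℤ (map (λ x → Σ∣ N (λ p → ind (does (isPeriodic? T p x)) (+ 1))) xs)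
        ≡⟨ sumℤ-Σ<-comm xs (suc N) _ ⟩
      Σ< (suc N) (λ p → sumℤ (map (λ x → ind (does (p ∣? N)) (ind (does (isPeriodic? T p x)) (+ 1))) xs))
        ≡⟨ Σ<-cong (suc N) (λ p _ → sym (trans (cong (ind (does (p ∣? N))) (length-filter (isPeriodic? T p) xs))
                                                (ind-sumℤ (does (p ∣? N)) xs _))) ⟩
      Σ∣ N (λ p → + numPer T p) ∎
      where
      open ≡-Reasoning
      xs = allVecs n

module Enumeration where

  open import Defs using (allVecs)
  open import Data.Nat using (_+_; _^_)
  open import Data.Vec using (Vec; []; _∷_)
  open import Data.List using (List; []; _∷_; map; filter; length; _++_)
  import Data.List.Properties as ListP
  open import Data.List.Relation.Unary.Any using (here)
  open import Data.List.Relation.Unary.All using (tabulate)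
  import Data.List.Relation.Unary.All as All
  open import Data.List.Relation.Unary.AllPairs using ([]; _∷_)
  open import Data.List.Membership.Propositional using (_∈_)
  open import Data.List.Membership.Propositional.Properties
    using (∈-map⁺; ∈-map⁻; ∈-++⁺ˡ; ∈-++⁺ʳ; ∈-filter⁺; ∈-filter⁻)
  open import Data.List.Membership.Propositional.Properties.WithK using (unique∧set⇒bag)
  open import Data.List.Relation.Unary.Unique.Propositional using (Unique)
  import Data.List.Relation.Unary.Unique.Propositional.Properties as UniqueP
  open import Data.List.Relation.Binary.BagAndSetEquality using (∼bag⇒↭)
  open import Data.List.Relation.Binary.Permutation.Propositional.Properties using (↭-length)
  open import Function.Bundles using (mk⇔)
  open import Relation.Unary using (Decidable)

  ∈-allVecs : ∀ {n} (x : Vec Bool n) → x ∈ allVecs n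
  ∈-allVecs []               = here refl
  ∈-allVecs {suc n} (false ∷ x) = ∈-++⁺ˡ (∈-map⁺ (false ∷_) (∈-allVecs x))
  ∈-allVecs {suc n} (true ∷ x)  = ∈-++⁺ʳ (map (false ∷_) (allVecs n)) (∈-map⁺ (true ∷_) (∈-allVecs x))

  allVecs-unique : ∀ n → Unique (allVecs n)
  allVecs-unique zero    = All.[] ∷ []
  allVecs-unique (suc n) = UniqueP.++⁺ (UniqueP.map⁺ ∷-injectiveʳ (allVecs-unique n))
                                      (UniqueP.map⁺ ∷-injectiveʳ (allVecs-unique n)) disjoint
    where
    ∷-injectiveʳ : ∀ {b} {x y : Vec Bool n} → b ∷ x ≡ b ∷ y → x ≡ y
    ∷-injectiveʳ refl = refl
    disjoint : ∀ {v} → ¬ (v ∈ map (false ∷_) (allVecs n) × v ∈ map (true ∷_) (allVecs n))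
    disjoint (v∈₀ , v∈₁) with ∈-map⁻ (false ∷_) v∈₀ | ∈-map⁻ (true ∷_) v∈₁
    ... | _ , _ , refl | _ , _ , ()

  length-allVecs : ∀ n → length (allVecs n) ≡ 2 ^ n
  length-allVecs zero    = refl
  length-allVecs (suc n) = begin
    length (map (false ∷_) (allVecs n) ++ map (true ∷_) (allVecs n))
      ≡⟨ ListP.length-++ (map (false ∷_) (allVecs n)) ⟩
    length (map (false ∷_) (allVecs n)) + length (map (true ∷_) (allVecs n))
      ≡⟨ cong₂ _+_ (ListP.length-map (false ∷_) (allVecs n)) (ListP.length-map (true ∷_) (allVecs n)) ⟩
    length (allVecs n) + length (allVecs n)
      ≡⟨ cong₂ _+_ (length-allVecs n) (trans (length-allVecs n) (sym (ℕP.+-identityʳ (2 ^ n)))) ⟩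
    2 ^ suc n ∎
    where open ≡-Reasoning

  length-filter-allVecs : ∀ {N k} {P : Vec Bool N → Set} (P? : Decidable P) (ψ : Vec Bool k → Vec Bool N) →
    (∀ {a b} → ψ a ≡ ψ b → a ≡ b) → (∀ a → P (ψ a)) → (∀ x → P x → ∃ λ a → ψ a ≡ x) →
    length (filter P? (allVecs N)) ≡ 2 ^ k
  length-filter-allVecs {N} {k} P? ψ injective into onto =
    trans (↭-length (∼bag⇒↭ (unique∧set⇒bag (UniqueP.filter⁺ P? (allVecs-unique N))
                                            (UniqueP.map⁺ injective (allVecs-unique k)) (mk⇔ to from))))
          (trans (ListP.length-map ψ (allVecs k)) (length-allVecs k))
    where
    to : ∀ {x} → x ∈ filter P? (allVecs N) → x ∈ map ψ (allVecs k)
    to {x} x∈ with onto x (proj₂ (∈-filter⁻ P? {xs = allVecs N} x∈))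
    ... | a , refl = ∈-map⁺ ψ (∈-allVecs a)
    from : ∀ {x} → x ∈ map ψ (allVecs k) → x ∈ filter P? (allVecs N)
    from x∈ with ∈-map⁻ ψ x∈
    ... | a , _ , refl = ∈-filter⁺ P? (∈-allVecs (ψ a)) (into a)

  length-filter-allVecs-none : ∀ {N} {P : Vec Bool N → Set} (P? : Decidable P) → (∀ x → ¬ P x) →
    length (filter P? (allVecs N)) ≡ 0
  length-filter-allVecs-none {N} P? none = cong length (ListP.filter-none P? {xs = allVecs N} (tabulate (λ {x} _ → none x)))

module BoolVec where
  open import Data.Fin using (Fin; toℕ)
  import Data.Fin as Fin
  open import Data.Vec using (Vec; []; _∷_; _∷ʳ_; lookup; _[_]≔_)

  infixl 9 _!_
  _!_ : ∀ {n} → Vec Bool n → ℕ → Bool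
  []      ! _     = false
  (a ∷ v) ! zero  = a
  (a ∷ v) ! suc j = v ! j

  lookup≡! : ∀ {n} (v : Vec Bool n) (i : Fin n) → lookup v i ≡ v ! toℕ i
  lookup≡! (a ∷ v) Fin.zero    = refl
  lookup≡! (a ∷ v) (Fin.suc i) = lookup≡! v i

  !-ext : ∀ {n} {v w : Vec Bool n} → (∀ j → j < n → v ! j ≡ w ! j) → v ≡ w
  !-ext {v = []}    {[]}    eq = refl
  !-ext {v = a ∷ v} {b ∷ w} eq = cong₂ _∷_ (eq 0 (s≤s z≤n)) (!-ext (λ j j<n → eq (suc j) (s≤s j<n)))

  !-[]≔-≡ : ∀ {n} (v : Vec Bool n) (i : Fin n) y → (v [ i ]≔ y) ! toℕ i ≡ y
  !-[]≔-≡ (a ∷ v) Fin.zero    y = refl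
  !-[]≔-≡ (a ∷ v) (Fin.suc i) y = !-[]≔-≡ v i y

  !-[]≔-≢ : ∀ {n} (v : Vec Bool n) (i : Fin n) y {j} → j ≢ toℕ i → (v [ i ]≔ y) ! j ≡ v ! j
  !-[]≔-≢ (a ∷ v) Fin.zero    y {zero}  j≢i = contradiction refl j≢i
  !-[]≔-≢ (a ∷ v) Fin.zero    y {suc j} j≢i = refl
  !-[]≔-≢ (a ∷ v) (Fin.suc i) y {zero}  j≢i = refl
  !-[]≔-≢ (a ∷ v) (Fin.suc i) y {suc j} j≢i = !-[]≔-≢ v i y (λ j≡i → j≢i (cong suc j≡i))

  !-∷ʳ-< : ∀ {k} (v : Vec Bool k) y {j} → j < k → (v ∷ʳ y) ! j ≡ v ! j
  !-∷ʳ-< (a ∷ v) y {zero}  _         = refl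
  !-∷ʳ-< (a ∷ v) y {suc j} (s≤s j<k) = !-∷ʳ-< v y j<k

  !-∷ʳ-last : ∀ {k} (v : Vec Bool k) y → (v ∷ʳ y) ! k ≡ y
  !-∷ʳ-last []      y = refl
  !-∷ʳ-last (a ∷ v) y = !-∷ʳ-last v y

  tabulateℕ : ∀ n → (ℕ → Bool) → Vec Bool n
  tabulateℕ zero    g = []
  tabulateℕ (suc n) g = g 0 ∷ tabulateℕ n (λ j → g (suc j))

  !-tabulateℕ : ∀ n (g : ℕ → Bool) {j} → j < n → tabulateℕ n g ! j ≡ g j
  !-tabulateℕ (suc n) g {zero}  _         = refl
  !-tabulateℕ (suc n) g {suc j} (s≤s j<n) = !-tabulateℕ n (λ j → g (suc j)) j<n

𝔽₂ : AlmostCommutativeRing _ _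
𝔽₂ = fromCommutativeRing xor-∧-commutativeRing λ { false → just refl ; true → nothing }

xor-≡false⇒≡ : ∀ {a b} → a xor b ≡ false → a ≡ b
xor-≡false⇒≡ {false} {false} _ = refl
xor-≡false⇒≡ {true}  {true}  _ = refl

xor-cancelˡ : ∀ a {b} → a xor b ≡ a → b ≡ false
xor-cancelˡ false refl = refl
xor-cancelˡ true  {false} _ = refl

module Sweep (m′ : ℕ) (f : Fin (suc (suc m′)) → LocalFn) where

  open BoolVec
  open import Data.Nat using (_+_; _%_)
  open import Data.Nat.DivMod using (m<n⇒m%n≡m; [m+n]%n≡m%n; n%n≡0)
  open import Data.Fin.Properties using (toℕ-fromℕ<; fromℕ<-toℕ; toℕ<n)
  open import Data.Vec using (Vec; lookup; _[_]≔_)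
  open import Data.List using (foldl; tabulate)

  m n : ℕ
  m = suc m′
  n = suc m

  -- f on ℕ-indexed vertices; the junk value beyond n is never used.
  fℕ : ℕ → LocalFn
  fℕ k with k ℕ.<? n
  ... | yes k<n = f (fromℕ< k<n)
  ... | no _    = parity₃

  f≡fℕ : ∀ i → f i ≡ fℕ (toℕ i)
  f≡fℕ i with toℕ i ℕ.<? n
  ... | yes i<n = cong f (sym (fromℕ<-toℕ i i<n))
  ... | no i≮n  = contradiction (toℕ<n i) i≮n

  constant : LocalFn → Bool
  constant parity₃    = false
  constant oneParity₃ = true

  evalFn-xor : ∀ g a b c → evalFn g a b c ≡ constant g xor (a xor (b xor c))
  evalFn-xor parity₃    a b c = refl
  evalFn-xor oneParity₃ a b c = refl

  c : ℕ → Bool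
  c k = constant (fℕ k)

  C : ℕ → Bool
  C zero    = c 0
  C (suc k) = C k xor c (suc k)

  module _ (x : Vec Bool n) where

    -- The value written at vertex k: its left neighbour has already been updated, and for the last
    -- vertex so has its right neighbour 0.
    Y : ℕ → Bool
    Y zero    = evalFn (fℕ 0) (x ! m) (x ! 0) (x ! 1)
    Y (suc k) = evalFn (fℕ (suc k)) (Y k) (x ! suc k) (if suc k ℕ.≡ᵇ m then Y 0 else x ! suc (suc k))

    SweptUpTo : ℕ → Vec Bool n → Set
    SweptUpTo k z = (∀ j → j < k → z ! j ≡ Y j) × (∀ j → k ≤ j → j < n → z ! j ≡ x ! j)

    private
      evalFn-cong : ∀ {g g′ a a′ b b′ d d′} → g ≡ g′ → a ≡ a′ → b ≡ b′ → d ≡ d′ → evalFn g a b d ≡ evalFn g′ a′ b′ d′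
      evalFn-cong refl refl refl refl = refl

      at : ∀ (z : Vec Bool n) {i : Fin n} {j} → toℕ i ≡ j → lookup z i ≡ z ! j
      at z {i} refl = lookup≡! z i

    sweep-value : ∀ {k} {i : Fin n} {z} → toℕ i ≡ k → SweptUpTo k z →
      evalFn (f i) (lookup z (prevV i)) (lookup z i) (lookup z (nextV i)) ≡ Y k
    sweep-value {zero} {i} {z} i≡0 (_ , unswept) = evalFn-cong (trans (f≡fℕ i) (cong fℕ i≡0))
      (trans (at z (trans (toℕ-fromℕ< _) (trans (cong (λ t → (t + m) % n) i≡0) (m<n⇒m%n≡m (ℕP.n<1+n m)))))
             (unswept m z≤n (ℕP.n<1+n m)))
      (trans (at z i≡0) (unswept 0 z≤n (s≤s z≤n)))
      (trans (at z (trans (toℕ-fromℕ< _) (trans (cong (λ t → (t + 1) % n) i≡0) (m<n⇒m%n≡m (s≤s (s≤s (z≤n {m′})))))))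
             (unswept 1 z≤n (s≤s (s≤s z≤n))))
    sweep-value {suc k} {i} {z} i≡1+k (swept , unswept) = evalFn-cong (trans (f≡fℕ i) (cong fℕ i≡1+k))
      (trans (at z (trans (toℕ-fromℕ< _) (trans (cong (λ t → (t + m) % n) i≡1+k) left)))
             (swept k ℕP.≤-refl))
      (trans (at z i≡1+k) (unswept (suc k) ℕP.≤-refl 1+k<n))
      right
      where
      1+k<n : suc k < n
      1+k<n = subst (_< n) i≡1+k (toℕ<n i)
      left : (suc k + m) % n ≡ k
      left = trans (cong (_% n) (sym (ℕP.+-suc k m))) (trans ([m+n]%n≡m%n k n) (m<n⇒m%n≡m (ℕP.<-trans (ℕP.n<1+n k) 1+k<n)))
      next : toℕ (nextV i) ≡ (suc k + 1) % n
      next = trans (toℕ-fromℕ< _) (cong (λ t → (t + 1) % n) i≡1+k)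
      right : lookup z (nextV i) ≡ (if suc k ℕ.≡ᵇ m then Y 0 else x ! suc (suc k))
      right with suc k ℕ.≟ m
      ... | yes refl rewrite dec-true (m ℕ.≟ m) refl =
        trans (at z (trans next (trans (cong (_% n) (ℕP.+-comm m 1)) (n%n≡0 n)))) (swept 0 (s≤s z≤n))
      ... | no 1+k≢m rewrite dec-false (suc k ℕ.≟ m) 1+k≢m =
        trans (at z (trans next (trans (cong (_% n) (ℕP.+-comm (suc k) 1)) (m<n⇒m%n≡m 2+k<n))))
              (unswept (suc (suc k)) (ℕP.n≤1+n (suc k)) 2+k<n)
        where
        2+k<n : suc (suc k) < n
        2+k<n = s≤s (ℕP.≤∧≢⇒< (ℕP.≤-pred 1+k<n) 1+k≢m)

    localUpdate-swept : ∀ {k} {i : Fin n} {z} → toℕ i ≡ k → SweptUpTo k z → SweptUpTo (suc k) (localUpdate f i z)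
    localUpdate-swept {k} {i} {z} i≡k sw@(swept , unswept) = swept′ , unswept′
      where
      new = evalFn (f i) (lookup z (prevV i)) (lookup z i) (lookup z (nextV i))
      swept′ : ∀ j → j < suc k → (z [ i ]≔ new) ! j ≡ Y j
      swept′ j j<1+k with ℕP.m≤n⇒m<n∨m≡n (ℕP.≤-pred j<1+k)
      ... | inj₁ j<k  = trans (!-[]≔-≢ z i new (λ j≡i → ℕP.<⇒≢ j<k (trans j≡i i≡k))) (swept j j<k)
      ... | inj₂ refl = trans (subst (λ t → (z [ i ]≔ new) ! t ≡ new) i≡k (!-[]≔-≡ z i new)) (sweep-value {z = z} i≡k sw)
      unswept′ : ∀ j → suc k ≤ j → j < n → (z [ i ]≔ new) ! j ≡ x ! j
      unswept′ j k<j j<n = trans (!-[]≔-≢ z i new (λ j≡i → ℕP.>⇒≢ k<j (trans j≡i i≡k))) (unswept j (ℕP.<⇒≤ k<j) j<n)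

    foldl-swept : ∀ len (h : Fin len → Fin n) {k z} → SweptUpTo k z → (∀ i → toℕ (h i) ≡ k + toℕ i) →
      SweptUpTo (k + len) (foldl (λ y i → localUpdate f i y) z (tabulate h))
    foldl-swept zero      h {k} {z} sw _    = subst (λ t → SweptUpTo t z) (sym (ℕP.+-identityʳ k)) sw
    foldl-swept (suc len) h {k} {z} sw toℕh = subst (λ t → SweptUpTo t (foldl (λ y i → localUpdate f i y) z (tabulate h)))
      (sym (ℕP.+-suc k len))
      (foldl-swept len (λ i → h (Fin.suc i)) (localUpdate-swept {z = z} (trans (toℕh Fin.zero) (ℕP.+-identityʳ k)) sw)
                   (λ i → trans (toℕh (Fin.suc i)) (ℕP.+-suc k (toℕ i))))

    SDS-! : ∀ {j} → j < n → SDS f x ! j ≡ Y j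
    SDS-! {j} j<n = proj₁ (foldl-swept n (λ i → i) ((λ _ ()) , (λ _ _ _ → refl)) (λ _ → refl)) j j<n

    Y-closed : ∀ {j} → j < m → Y j ≡ (x ! 0 xor x ! m) xor (x ! suc j xor C j)
    Y-closed {zero} _ = trans (evalFn-xor (fℕ 0) (x ! m) (x ! 0) (x ! 1)) (regroup (c 0) (x ! m) (x ! 0) (x ! 1))
      where
      regroup : ∀ c₀ xₘ x₀ x₁ → c₀ xor (xₘ xor (x₀ xor x₁)) ≡ (x₀ xor xₘ) xor (x₁ xor c₀)
      regroup = solve-∀ 𝔽₂
    Y-closed {suc k} 2+k≤m rewrite dec-false (suc k ℕ.≟ m) (ℕP.<⇒≢ 2+k≤m) =
      trans (evalFn-xor (fℕ (suc k)) (Y k) (x ! suc k) (x ! suc (suc k)))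
            (trans (cong (λ y → c (suc k) xor (y xor (x ! suc k xor x ! suc (suc k)))) (Y-closed (ℕP.<⇒≤ 2+k≤m)))
                   (regroup (c (suc k)) (x ! 0 xor x ! m) (x ! suc k) (C k) (x ! suc (suc k))))
      where
      regroup : ∀ c₁ s x₁ C₀ x₂ → c₁ xor ((s xor (x₁ xor C₀)) xor (x₁ xor x₂)) ≡ s xor (x₂ xor (C₀ xor c₁))
      regroup = solve-∀ 𝔽₂

    Y-last : Y m ≡ c m xor (Y m′ xor (x ! m xor Y 0))
    Y-last rewrite dec-true (m ℕ.≟ m) refl = evalFn-xor (fℕ m) (Y m′) (x ! m) (Y 0)

module Parity where

  open import Data.Nat using (_+_; _*_)
  open import Data.Nat.Divisibility using (_∣_; divides)

  parity : ℕ → Bool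
  parity zero    = false
  parity (suc i) = not (parity i)

  parity-+ : ∀ a b → parity (a + b) ≡ parity a xor parity b
  parity-+ zero    b = refl
  parity-+ (suc a) b rewrite parity-+ a b = not-distribˡ-xor (parity a) (parity b)

  parity-* : ∀ a b → parity (a * b) ≡ parity a ∧ parity b
  parity-* zero    b = refl
  parity-* (suc a) b rewrite parity-+ b (a * b) | parity-* a b = expand (parity a) (parity b)
    where
    expand : ∀ p q → q xor (p ∧ q) ≡ (true xor p) ∧ q
    expand = solve-∀ 𝔽₂

  parity-2* : ∀ k → parity (2 * k) ≡ false
  parity-2* k = parity-* 2 k

  parity≡false⇒even : ∀ x → parity x ≡ false → 2 ∣ x
  parity≡false⇒even zero          _    = divides 0 refl
  parity≡false⇒even (suc (suc x)) even with parity≡false⇒even x (trans (sym (not-involutive (parity x))) even)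
  ... | divides q x≡2q = divides (suc q) (cong (λ k → suc (suc k)) x≡2q)

  even⇒parity≡false : ∀ {x} → 2 ∣ x → parity x ≡ false
  even⇒parity≡false {x} (divides q refl) = trans (parity-* q 2) (∧-zeroʳ (parity q))

  odd⇒parity≡true : ∀ {x} → ¬ 2 ∣ x → parity x ≡ true
  odd⇒parity≡true {x} odd with parity x in eq
  ... | true  = refl
  ... | false = contradiction (parity≡false⇒even x eq) odd

  parity≡true⇒2*+1 : ∀ x → parity x ≡ true → ∃ λ h → x ≡ suc (2 * h)
  parity≡true⇒2*+1 (suc zero)    _   = 0 , refl
  parity≡true⇒2*+1 (suc (suc x)) odd with parity≡true⇒2*+1 x (trans (sym (not-involutive (parity x))) odd)
  ... | h , refl = suc h , cong (λ k → suc (suc k)) (sym (ℕP.+-suc h (h + 0)))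

module Cofactors where

  open Parity
  open import Data.Nat using (_+_; _*_; _∸_; _/_)
  open import Data.Nat.DivMod using (m*n/n≡m)
  open import Data.Nat.Divisibility using (_∣_; divides; ∣m⇒∣m*n; ∣n⇒∣m*n)
  open import Defs using (_∣ₒ_)
  import Data.Nat.Tactic.RingSolver as ℕ-Solver

  2*[1+m]∸2≡m+m : ∀ m → 2 * suc m ∸ 2 ≡ m + m
  2*[1+m]∸2≡m+m m = trans (cong (_∸ 1) (ℕP.+-suc m (m + 0))) (cong (_+_ m) (ℕP.+-identityʳ m))

  halve : ∀ {a b} → a + a ≡ 2 * b → a ≡ b
  halve {a} {b} a+a≡2b = ℕP.*-cancelˡ-≡ a b 2 (trans (cong (_+_ a) (ℕP.+-identityʳ a)) a+a≡2b)

  even-cofactor⇒∣ : ∀ {m d e} → m + m ≡ e * d → 2 ∣ e → d ∣ m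
  even-cofactor⇒∣ {m} {d} m+m≡q2d (divides q refl) = divides q (halve (trans m+m≡q2d (regroup q d)))
    where
    regroup : ∀ q d → q * 2 * d ≡ 2 * (q * d)
    regroup = ℕ-Solver.solve-∀

  cofactor-odd : ∀ {m d e} → m + m ≡ e * d → ¬ d ∣ m → parity e ≡ true
  cofactor-odd {e = e} m+m≡ed d∤m with parity e in eq
  ... | true  = refl
  ... | false = contradiction (even-cofactor⇒∣ m+m≡ed (parity≡false⇒even e eq)) d∤m

  odd-cofactor⇒even : ∀ {m d e} → m + m ≡ e * d → parity e ≡ true → 1 ≤ d →
    ∃ λ t′ → d ≡ 2 * suc t′ × m ≡ e * suc t′
  odd-cofactor⇒even {m} {d} {e} m+m≡ed odd 1≤d with parity≡false⇒even d parity-d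
    where
    parity-d : parity d ≡ false
    parity-d = trans (sym (trans (parity-* e d) (cong (_∧ parity d) odd)))
                     (trans (cong parity (sym m+m≡ed)) (trans (parity-+ m m) (xor-same (parity m))))
  ... | divides (suc t′) refl = t′ , ℕP.*-comm (suc t′) 2 , halve (trans m+m≡ed (regroup e t′))
    where
    regroup : ∀ e t′ → e * (suc t′ * 2) ≡ 2 * (e * suc t′)
    regroup = ℕ-Solver.solve-∀

  ∣ₒ-transfer : ∀ {N r d p} → 1 ≤ p → p ∣ₒ N → r ∣ₒ N → d ∣ r → p ∣ d → d ∣ₒ r
  ∣ₒ-transfer {N} {r} {d} {p} 1≤p (e , N≡ep , e-odd) (q , N≡qr , _) (divides b r≡bd) (divides a d≡ap) =
    b , r≡bd , b-odd
    where
    e≡qba : e ≡ q * b * a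
    e≡qba = ℕP.*-cancelʳ-≡ e (q * b * a) p {{ℕ.>-nonZero 1≤p}} (begin
      e * p               ≡⟨ N≡ep ⟨
      N                   ≡⟨ N≡qr ⟩
      q * r               ≡⟨ cong (q *_) (trans r≡bd (cong (b *_) d≡ap)) ⟩
      q * (b * (a * p))   ≡⟨ regroup q b a p ⟩
      q * b * a * p       ∎)
      where
      open ≡-Reasoning
      regroup : ∀ q b a p → q * (b * (a * p)) ≡ q * b * a * p
      regroup = ℕ-Solver.solve-∀
    b-odd : ¬ 2 ∣ b
    b-odd 2∣b = e-odd (subst (2 ∣_) (sym e≡qba) (∣m⇒∣m*n a (∣n⇒∣m*n q 2∣b)))

  2*[1+t]/2+1 : ∀ t′ → 2 * suc t′ / 2 + 1 ≡ suc (suc t′)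
  2*[1+t]/2+1 t′ =
    trans (cong (_+ 1) (trans (cong (_/ 2) (ℕP.*-comm 2 (suc t′))) (m*n/n≡m (suc t′) 2))) (ℕP.+-comm (suc t′) 1)

module Recurrence where

  open Parity
  open import Data.Nat using (_+_; _*_; _∸_; _/_; _%_; NonZero)
  open import Data.Nat.DivMod using (m≡m%n+[m/n]*n; m<n⇒m/n≡0; m<n⇒m%n≡m; m/n≡1+[m∸n]/n; [m+n]%n≡m%n)
  open import Data.Nat.Induction using (<-rec)
  import Data.Nat.Tactic.RingSolver as ℕ-Solver

  Recurrent : ℕ → (ℕ → Bool) → (ℕ → Bool) → Set
  Recurrent t β v = ∀ j → v (j + t) ≡ v j xor β j

  Periodic : ℕ → (ℕ → Bool) → Set
  Periodic d v = ∀ j → v (j + d) ≡ v j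

  module _ {t} (1≤t : 1 ≤ t) (P : ℕ → Set) (base : ∀ j → j < t → P j) (step : ∀ j → P j → P (j + t)) where

    stride-induction : ∀ j → P j
    stride-induction = <-rec P go
      where
      go : ∀ j → (∀ {i} → i < j → P i) → P j
      go j ih with j ℕ.<? t
      ... | yes j<t = base j j<t
      ... | no j≮t  = subst P (ℕP.m∸n+n≡m t≤j) (step (j ∸ t) (ih (ℕP.∸-monoʳ-< 1≤t t≤j)))
        where
        t≤j : t ≤ j
        t≤j = ℕP.≮⇒≥ j≮t

  recurrent-unique : ∀ {t β v v′} → 1 ≤ t → Recurrent t β v → Recurrent t β v′ →
    (∀ j → j < t → v j ≡ v′ j) → ∀ j → v j ≡ v′ j
  recurrent-unique {t} {β} {v} {v′} 1≤t rec rec′ agree =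
    stride-induction 1≤t (λ j → v j ≡ v′ j) agree (λ j eq → trans (rec j) (trans (cong (_xor β j) eq) (sym (rec′ j))))

  periodic-extend : ∀ {m d a v} → 1 ≤ m → Recurrent m a v → Periodic d a →
    (∀ i → i < m → v (i + d) ≡ v i) → Periodic d v
  periodic-extend {m} {d} {a} {v} 1≤m rec a-per agree = stride-induction 1≤m (λ j → v (j + d) ≡ v j) agree step
    where
    step : ∀ j → v (j + d) ≡ v j → v (j + m + d) ≡ v (j + m)
    step j eq = begin
      v (j + m + d)             ≡⟨ cong v (ℕP.+-assoc j m d) ⟩
      v (j + (m + d))           ≡⟨ cong (λ k → v (j + k)) (ℕP.+-comm m d) ⟩
      v (j + (d + m))           ≡⟨ cong v (ℕP.+-assoc j d m) ⟨
      v (j + d + m)             ≡⟨ rec (j + d) ⟩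
      v (j + d) xor a (j + d)   ≡⟨ cong₂ _xor_ eq (a-per j) ⟩
      v j xor a j               ≡⟨ rec j ⟨
      v (j + m)                 ∎
      where open ≡-Reasoning

  periodic-* : ∀ {p v} → Periodic p v → ∀ k j → v (j + k * p) ≡ v j
  periodic-* {p} {v} per zero    j = cong v (ℕP.+-identityʳ j)
  periodic-* {p} {v} per (suc k) j = begin
    v (j + (p + k * p))   ≡⟨ cong (λ i → v (j + i)) (ℕP.+-comm p (k * p)) ⟩
    v (j + (k * p + p))   ≡⟨ cong v (ℕP.+-assoc j (k * p) p) ⟨
    v (j + k * p + p)     ≡⟨ per (j + k * p) ⟩
    v (j + k * p)         ≡⟨ periodic-* per k j ⟩
    v j                   ∎
    where open ≡-Reasoning

  recurrent-* : ∀ {t β v} → Recurrent t β v → Periodic t β → ∀ k j → v (j + k * t) ≡ v j xor (parity k ∧ β j)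
  recurrent-* {t} {β} {v} rec β-per zero    j = trans (cong v (ℕP.+-identityʳ j)) (sym (xor-identityʳ (v j)))
  recurrent-* {t} {β} {v} rec β-per (suc k) j = begin
    v (j + (t + k * t))                   ≡⟨ cong (λ i → v (j + i)) (ℕP.+-comm t (k * t)) ⟩
    v (j + (k * t + t))                   ≡⟨ cong v (ℕP.+-assoc j (k * t) t) ⟨
    v (j + k * t + t)                     ≡⟨ rec (j + k * t) ⟩
    v (j + k * t) xor β (j + k * t)       ≡⟨ cong₂ _xor_ (recurrent-* {v = v} rec β-per k j) (periodic-* β-per k j) ⟩
    (v j xor (parity k ∧ β j)) xor β j    ≡⟨ regroup (v j) (parity k) (β j) ⟩
    v j xor (parity (suc k) ∧ β j)        ∎
    where
    open ≡-Reasoning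
    regroup : ∀ a p b → (a xor (p ∧ b)) xor b ≡ a xor ((true xor p) ∧ b)
    regroup = solve-∀ 𝔽₂

  recurrent-odd-* : ∀ {t β v q} → Recurrent t β v → Periodic t β → parity q ≡ true → Recurrent (q * t) β v
  recurrent-odd-* {v = v} {q} rec β-per odd j rewrite recurrent-* {v = v} rec β-per q j | odd = refl

  recurrent⇒periodic-2* : ∀ {t β v} → Recurrent t β v → Periodic t β → Periodic (2 * t) v
  recurrent⇒periodic-2* {v = v} rec β-per j = trans (recurrent-* {v = v} rec β-per 2 j) (xor-identityʳ (v j))

  recurrent-odd-/ : ∀ {t β v} h → Recurrent (suc (2 * h) * t) β v → Periodic (2 * t) v → Recurrent t β v
  recurrent-odd-/ {t} {β} {v} h rec per j = begin
    v (j + t)                   ≡⟨ periodic-* per h (j + t) ⟨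
    v (j + t + h * (2 * t))     ≡⟨ cong v (arith j t h) ⟩
    v (j + suc (2 * h) * t)     ≡⟨ rec j ⟩
    v j xor β j                 ∎
    where
    open ≡-Reasoning
    arith : ∀ j t h → j + t + h * (2 * t) ≡ j + suc (2 * h) * t
    arith = ℕ-Solver.solve-∀

  recurrent∧periodic⇒vanishing : ∀ {q d a v} → Recurrent (q * d) a v → Periodic d v → ∀ j → a j ≡ false
  recurrent∧periodic⇒vanishing {q} {d} {a} {v} rec per j = xor-cancelˡ (v j) (trans (sym (rec j)) (periodic-* per q j))

  recurrent-false⇒periodic : ∀ {t v} → Recurrent t (λ _ → false) v → Periodic t v
  recurrent-false⇒periodic {v = v} rec j = trans (rec j) (xor-identityʳ (v j))

  periodic⇒recurrent-* : ∀ {t a v} q → Periodic t v → (∀ j → a j ≡ false) → Recurrent (q * t) a v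
  periodic⇒recurrent-* {v = v} q per a≡false j =
    trans (periodic-* per q j) (sym (trans (cong (v j xor_) (a≡false j)) (xor-identityʳ (v j))))

  module _ {t} .{{_ : NonZero t}} (β b : ℕ → Bool) where

    private
      fromBlock : ℕ → ℕ → Bool
      fromBlock zero    r = b r
      fromBlock (suc q) r = fromBlock q r xor β (r + q * t)

    solution : ℕ → Bool
    solution j = fromBlock (j / t) (j % t)

    solution-< : ∀ {j} → j < t → solution j ≡ b j
    solution-< {j} j<t rewrite m<n⇒m/n≡0 j<t | m<n⇒m%n≡m j<t = refl

    solution-recurrent : Recurrent t β solution
    solution-recurrent j =
      trans (cong₂ fromBlock quotient remainder) (cong (λ i → solution j xor β i) (sym (m≡m%n+[m/n]*n j t)))
      where
      quotient : (j + t) / t ≡ suc (j / t)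
      quotient = trans (m/n≡1+[m∸n]/n (ℕP.m≤n+m t j)) (cong (λ i → suc (i / t)) (ℕP.m+n∸n≡m j t))
      remainder : (j + t) % t ≡ j % t
      remainder = [m+n]%n≡m%n j t

module ShiftRegister (m′ : ℕ) (f : Fin (suc (suc m′)) → LocalFn) where

  open BoolVec
  open Parity
  open Recurrence
  open Sweep m′ f
  open PeriodicPoints using (iterate-+)
  open import Defs using (iterate)
  open import Data.Nat using (_+_)
  open import Data.Vec using (Vec; _∷ʳ_)

  T : Vec Bool n → Vec Bool n
  T = SDS f

  γ τ ε : Bool
  D : ℕ → Bool
  γ = C m
  τ = parity m′
  D zero    = false
  D (suc i) = D i xor (C i xor (parity i ∧ γ))
  ε = D m

  s : Vec Bool n → Bool
  s x = x ! 0 xor x ! m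

  u : Vec Bool n → ℕ → Bool
  u x i = (x ! i xor (parity i ∧ s x)) xor D i

  s-T : ∀ x → s (T x) ≡ s x xor γ
  s-T x rewrite SDS-! x {0} (s≤s z≤n) | SDS-! x {m} ℕP.≤-refl | Y-last x | Y-closed x {m′} ℕP.≤-refl =
    regroup (Y x 0) (c m) (s x) (x ! m) (C m′)
    where
    regroup : ∀ y₀ cₘ s₀ xₘ C₀ → y₀ xor (cₘ xor ((s₀ xor (xₘ xor C₀)) xor (xₘ xor y₀))) ≡ s₀ xor (C₀ xor cₘ)
    regroup = solve-∀ 𝔽₂

  u-T : ∀ x {i} → suc i < m → u (T x) i ≡ u x (suc i)
  u-T x {i} 1+i<m rewrite s-T x | SDS-! x {i} (ℕP.<-trans (ℕP.<-trans (ℕP.n<1+n i) 1+i<m) (ℕP.n<1+n m))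
                         | Y-closed x {i} (ℕP.<⇒≤ 1+i<m) =
    regroup (s x) (x ! suc i) (C i) (parity i) γ (D i)
    where
    regroup : ∀ s₀ x₁ C₀ p g d →
      ((s₀ xor (x₁ xor C₀)) xor (p ∧ (s₀ xor g))) xor d ≡ (x₁ xor ((true xor p) ∧ s₀)) xor (d xor (C₀ xor (p ∧ g)))
    regroup = solve-∀ 𝔽₂

  u-T-last : ∀ x → u (T x) m′ ≡ u x 0 xor ((τ ∧ s x) xor ε)
  u-T-last x rewrite s-T x | SDS-! x {m′} (ℕP.<-trans (ℕP.n<1+n m′) (ℕP.n<1+n m)) | Y-closed x {m′} ℕP.≤-refl =
    regroup (x ! 0) (x ! m) (C m′) τ γ (D m′)
    where
    regroup : ∀ x₀ xₘ C₀ t g d →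
      (((x₀ xor xₘ) xor (xₘ xor C₀)) xor (t ∧ ((x₀ xor xₘ) xor g))) xor d
        ≡ ((x₀ xor false) xor false) xor ((t ∧ (x₀ xor xₘ)) xor (d xor (C₀ xor (t ∧ g))))
    regroup = solve-∀ 𝔽₂

  ψ : Bool → (ℕ → Bool) → ℕ → Bool
  ψ s₀ v j = (v j xor (parity j ∧ s₀)) xor D j

  Ψ : Bool → (ℕ → Bool) → Vec Bool n
  Ψ s₀ v = tabulateℕ m (ψ s₀ v) ∷ʳ (s₀ xor v 0)

  Ψ-!-< : ∀ s₀ v {j} → j < m → Ψ s₀ v ! j ≡ (v j xor (parity j ∧ s₀)) xor D j
  Ψ-!-< s₀ v j<m = trans (!-∷ʳ-< (tabulateℕ m (ψ s₀ v)) (s₀ xor v 0) j<m) (!-tabulateℕ m (ψ s₀ v) j<m)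

  Ψ-!-last : ∀ s₀ v → Ψ s₀ v ! m ≡ s₀ xor v 0
  Ψ-!-last s₀ v = !-∷ʳ-last (tabulateℕ m (ψ s₀ v)) (s₀ xor v 0)

  s-Ψ : ∀ s₀ v → s (Ψ s₀ v) ≡ s₀
  s-Ψ s₀ v rewrite Ψ-!-< s₀ v {0} (s≤s z≤n) | Ψ-!-last s₀ v = cancel (v 0) s₀
    where
    cancel : ∀ v₀ s₀ → ((v₀ xor false) xor false) xor (s₀ xor v₀) ≡ s₀
    cancel = solve-∀ 𝔽₂

  u-Ψ : ∀ s₀ v {i} → i < m → u (Ψ s₀ v) i ≡ v i
  u-Ψ s₀ v {i} i<m rewrite s-Ψ s₀ v | Ψ-!-< s₀ v i<m = cancel (v i) (parity i ∧ s₀) (D i)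
    where
    cancel : ∀ a b d → (((a xor b) xor d) xor b) xor d ≡ a
    cancel = solve-∀ 𝔽₂

  Ψ-cong : ∀ s₀ {v v′} → (∀ i → i < m → v i ≡ v′ i) → Ψ s₀ v ≡ Ψ s₀ v′
  Ψ-cong s₀ {v} {v′} eq = !-ext pointwise
    where
    pointwise : ∀ j → j < n → Ψ s₀ v ! j ≡ Ψ s₀ v′ ! j
    pointwise j j<n with ℕP.m≤n⇒m<n∨m≡n (ℕP.≤-pred j<n)
    ... | inj₁ j<m rewrite Ψ-!-< s₀ v j<m | Ψ-!-< s₀ v′ j<m | eq j j<m = refl
    ... | inj₂ refl rewrite Ψ-!-last s₀ v | Ψ-!-last s₀ v′ | eq 0 (s≤s z≤n) = refl

  Ψ-s-u : ∀ x → Ψ (s x) (u x) ≡ x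
  Ψ-s-u x = !-ext pointwise
    where
    pointwise : ∀ j → j < n → Ψ (s x) (u x) ! j ≡ x ! j
    pointwise j j<n with ℕP.m≤n⇒m<n∨m≡n (ℕP.≤-pred j<n)
    ... | inj₁ j<m rewrite Ψ-!-< (s x) (u x) j<m = cancel (x ! j) (parity j ∧ s x) (D j)
      where
      cancel : ∀ a b d → (((a xor b) xor d) xor b) xor d ≡ a
      cancel = solve-∀ 𝔽₂
    ... | inj₂ refl rewrite Ψ-!-last (s x) (u x) = cancel (x ! 0) (x ! m)
      where
      cancel : ∀ x₀ xₘ → (x₀ xor xₘ) xor ((x₀ xor false) xor false) ≡ xₘ
      cancel = solve-∀ 𝔽₂

  coordinates-injective : ∀ {x y} → s x ≡ s y → (∀ i → i < m → u x i ≡ u y i) → x ≡ y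
  coordinates-injective {x} {y} sx≡sy ux≡uy = begin
    x                ≡⟨ Ψ-s-u x ⟨
    Ψ (s x) (u x)    ≡⟨ cong (λ s₀ → Ψ s₀ (u x)) sx≡sy ⟩
    Ψ (s y) (u x)    ≡⟨ Ψ-cong (s y) ux≡uy ⟩
    Ψ (s y) (u y)    ≡⟨ Ψ-s-u y ⟩
    y                ∎
    where open ≡-Reasoning

  w : Vec Bool n → ℕ → Bool
  w x j = u (iterate T j x) 0

  u-iterate : ∀ k x {i} → i + k < m → u (iterate T k x) i ≡ u x (i + k)
  u-iterate zero    x {i} _       = cong (u x) (sym (ℕP.+-identityʳ i))
  u-iterate (suc k) x {i} i+1+k<m =
    trans (u-T (iterate T k x) (ℕP.≤-<-trans (ℕP.m≤m+n (suc i) k) 1+i+k<m))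
          (trans (u-iterate k x 1+i+k<m) (cong (u x) (sym (ℕP.+-suc i k))))
    where
    1+i+k<m : suc i + k < m
    1+i+k<m = subst (_< m) (ℕP.+-suc i k) i+1+k<m

  u≡w : ∀ x j {i} → i < m → u (iterate T j x) i ≡ w x (i + j)
  u≡w x j {i} i<m = sym (trans (cong (λ y → u y 0) (iterate-+ T i j x)) (u-iterate i (iterate T j x) i<m))

  u≡w₀ : ∀ x {i} → i < m → u x i ≡ w x i
  u≡w₀ x {i} i<m = trans (u≡w x 0 i<m) (cong (w x) (ℕP.+-identityʳ i))

  s-iterate : ∀ j x → s (iterate T j x) ≡ s x xor (parity j ∧ γ)
  s-iterate zero    x = sym (xor-identityʳ (s x))
  s-iterate (suc j) x = trans (s-T (iterate T j x)) (trans (cong (_xor γ) (s-iterate j x)) (regroup (s x) (parity j) γ))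
    where
    regroup : ∀ s₀ p g → (s₀ xor (p ∧ g)) xor g ≡ s₀ xor ((true xor p) ∧ g)
    regroup = solve-∀ 𝔽₂

  A : Bool → ℕ → Bool
  A s₀ j = (τ ∧ (s₀ xor (parity j ∧ γ))) xor ε

  w-recurrence : ∀ x j → w x (j + m) ≡ w x j xor A (s x) j
  w-recurrence x j = begin
    u (iterate T (j + m) x) 0              ≡⟨ cong (λ k → u (iterate T k x) 0) (ℕP.+-comm j m) ⟩
    u (iterate T (m + j) x) 0              ≡⟨ cong (λ z → u z 0) (iterate-+ T m j x) ⟩
    u (iterate T (1 + m′) y) 0             ≡⟨ cong (λ k → u (iterate T k y) 0) (ℕP.+-comm 1 m′) ⟩
    u (iterate T (m′ + 1) y) 0             ≡⟨ cong (λ z → u z 0) (iterate-+ T m′ 1 y) ⟩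
    u (iterate T m′ (T y)) 0               ≡⟨ u-iterate m′ (T y) ℕP.≤-refl ⟩
    u (T y) m′                             ≡⟨ u-T-last y ⟩
    u y 0 xor ((τ ∧ s y) xor ε)            ≡⟨ cong (λ s₀ → u y 0 xor ((τ ∧ s₀) xor ε)) (s-iterate j x) ⟩
    w x j xor A (s x) j                    ∎
    where
    open ≡-Reasoning
    y = iterate T j x

  iterate-fixed⇒ : ∀ {d x} → iterate T d x ≡ x → (parity d ∧ γ) ≡ false × (∀ i → i < m → w x (i + d) ≡ w x i)
  iterate-fixed⇒ {d} {x} Tᵈx≡x =
    xor-cancelˡ (s x) (trans (sym (s-iterate d x)) (cong s Tᵈx≡x)) ,
    λ i i<m → trans (sym (u≡w x d i<m)) (trans (cong (λ y → u y i) Tᵈx≡x) (u≡w₀ x i<m))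

  iterate-fixed⇐ : ∀ {d x} → (parity d ∧ γ) ≡ false → (∀ i → i < m → w x (i + d) ≡ w x i) → iterate T d x ≡ x
  iterate-fixed⇐ {d} {x} even w-per = coordinates-injective
    (trans (s-iterate d x) (trans (cong (s x xor_) even) (xor-identityʳ (s x))))
    (λ i i<m → trans (u≡w x d i<m) (trans (w-per i i<m) (sym (u≡w₀ x i<m))))

  w-unique : ∀ y {v} → Recurrent m (A (s y)) v → (∀ i → i < m → v i ≡ u y i) → ∀ j → w y j ≡ v j
  w-unique y rec init =
    recurrent-unique (s≤s z≤n) (w-recurrence y) rec (λ j j<m → trans (sym (u≡w₀ y j<m)) (sym (init j j<m)))

  fixed⇒w-periodic : ∀ {d y} → Periodic d (A (s y)) → iterate T d y ≡ y → Periodic d (w y)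
  fixed⇒w-periodic {y = y} A-per Tᵈy≡y = periodic-extend (s≤s z≤n) (w-recurrence y) A-per (proj₂ (iterate-fixed⇒ Tᵈy≡y))

  A-periodic : ∀ {t} → parity t ≡ not τ → ∀ s₀ → Periodic t (A s₀)
  A-periodic {t} parity-t s₀ j =
    trans (cong (λ p → (τ ∧ (s₀ xor (p ∧ γ))) xor ε) (trans (parity-+ j t) (cong (parity j xor_) parity-t)))
          (cong (_xor ε) (absorb τ))
    where
    absorb : ∀ t′ → (t′ ∧ (s₀ xor ((parity j xor not t′) ∧ γ))) ≡ (t′ ∧ (s₀ xor (parity j ∧ γ)))
    absorb false = refl
    absorb true  = cong (λ p → s₀ xor (p ∧ γ)) (xor-identityʳ (parity j))

  A-γ≡false : γ ≡ false → ∀ s₀ j → A s₀ j ≡ (τ ∧ s₀) xor ε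
  A-γ≡false γ≡false s₀ j rewrite γ≡false | ∧-zeroʳ (parity j) | xor-identityʳ s₀ = refl

module FixedPoints (m′ : ℕ) (f : Fin (suc (suc m′)) → LocalFn) where

  open BoolVec
  open Parity
  open Cofactors
  open Recurrence
  open Sweep m′ f using (m; n)
  open ShiftRegister m′ f
  open PeriodicPoints using (#Fix; fixed?)
  open Enumeration using (length-filter-allVecs)
  open import Defs using (iterate; HasFixedPoint)
  open import Data.Nat using (_+_; _*_; _^_; _/_; NonZero)
  open import Data.Nat.Divisibility using (_∣_; divides)
  open import Data.Vec using (Vec; _∷_)

  -- The states x = Ψ s₀ v whose orbit sequence v solves v (j + t) = v j ⊕ β s₀ j are parametrised
  -- by s₀ and the first t terms of v.
  module Parametrisation {t} .{{_ : NonZero t}} (t≤m : t ≤ m) (β : Bool → ℕ → Bool) where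

    orbit : Bool → Vec Bool t → ℕ → Bool
    orbit s₀ b = solution (β s₀) (b !_)

    state : Bool → Vec Bool t → Vec Bool n
    state s₀ b = Ψ s₀ (orbit s₀ b)

    state-injective : ∀ {s₀ s₁ b b′} → state s₀ b ≡ state s₁ b′ → s₀ ≡ s₁ × b ≡ b′
    state-injective {s₀} {s₁} {b} {b′} eq = s₀≡s₁ , !-ext b≗b′
      where
      s₀≡s₁ : s₀ ≡ s₁
      s₀≡s₁ = trans (sym (s-Ψ s₀ (orbit s₀ b))) (trans (cong s eq) (s-Ψ s₁ (orbit s₁ b′)))
      b≗b′ : ∀ j → j < t → b ! j ≡ b′ ! j
      b≗b′ j j<t = begin
        b ! j                  ≡⟨ solution-< (β s₀) (b !_) j<t ⟨
        orbit s₀ b j           ≡⟨ u-Ψ s₀ (orbit s₀ b) j<m ⟨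
        u (state s₀ b) j       ≡⟨ cong (λ x → u x j) eq ⟩
        u (state s₁ b′) j      ≡⟨ u-Ψ s₁ (orbit s₁ b′) j<m ⟩
        orbit s₁ b′ j          ≡⟨ solution-< (β s₁) (b′ !_) j<t ⟩
        b′ ! j                 ∎
        where
        open ≡-Reasoning
        j<m = ℕP.<-≤-trans j<t t≤m

    state-fixed : ∀ {d} s₀ b → Recurrent m (A s₀) (orbit s₀ b) → Periodic d (orbit s₀ b) → (parity d ∧ γ) ≡ false →
      iterate T d (state s₀ b) ≡ state s₀ b
    state-fixed {d} s₀ b rec per even =
      iterate-fixed⇐ even (λ i _ → trans (w≗orbit (i + d)) (trans (per i) (sym (w≗orbit i))))
      where
      w≗orbit : ∀ j → w (state s₀ b) j ≡ orbit s₀ b j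
      w≗orbit = w-unique (state s₀ b) (subst (λ s₁ → Recurrent m (A s₁) (orbit s₀ b)) (sym (s-Ψ s₀ (orbit s₀ b))) rec)
                         (λ i i<m → sym (u-Ψ s₀ (orbit s₀ b) i<m))

    state-onto : ∀ y → Recurrent t (β (s y)) (w y) → state (s y) (tabulateℕ t (w y)) ≡ y
    state-onto y rec = coordinates-injective (s-Ψ (s y) v)
      (λ i i<m → trans (u-Ψ (s y) v i<m) (trans (v≗w i) (sym (u≡w₀ y i<m))))
      where
      v = orbit (s y) (tabulateℕ t (w y))
      v≗w : ∀ j → v j ≡ w y j
      v≗w = recurrent-unique (ℕ.>-nonZero⁻¹ t) (solution-recurrent (β (s y)) _) rec
              (λ j j<t → trans (solution-< (β (s y)) _ j<t) (!-tabulateℕ t (w y) j<t))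

    #Fix-free : ∀ {d} → (parity d ∧ γ) ≡ false →
      (∀ s₀ b → Recurrent m (A s₀) (orbit s₀ b) × Periodic d (orbit s₀ b)) →
      (∀ y → iterate T d y ≡ y → Recurrent t (β (s y)) (w y)) →
      #Fix T d ≡ 2 ^ suc t
    #Fix-free {d} even into onto = length-filter-allVecs (fixed? T d) stateOf injective
      (λ { (s₀ ∷ b) → state-fixed s₀ b (proj₁ (into s₀ b)) (proj₂ (into s₀ b)) even })
      (λ y Tᵈy≡y → s y ∷ tabulateℕ t (w y) , state-onto y (onto y Tᵈy≡y))
      where
      stateOf : Vec Bool (suc t) → Vec Bool n
      stateOf (s₀ ∷ b) = state s₀ b
      injective : ∀ {a a′} → stateOf a ≡ stateOf a′ → a ≡ a′
      injective {s₀ ∷ b} {s₁ ∷ b′} eq with state-injective {s₀} {s₁} {b} {b′} eq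
      ... | refl , refl = refl

    #Fix-pinned : ∀ {d} s₀ → (parity d ∧ γ) ≡ false →
      (∀ b → Recurrent m (A s₀) (orbit s₀ b) × Periodic d (orbit s₀ b)) →
      (∀ y → iterate T d y ≡ y → s y ≡ s₀ × Recurrent t (β (s y)) (w y)) →
      #Fix T d ≡ 2 ^ t
    #Fix-pinned {d} s₀ even into onto = length-filter-allVecs (fixed? T d) (state s₀) (λ eq → proj₂ (state-injective eq))
      (λ b → state-fixed s₀ b (proj₁ (into b)) (proj₂ (into b)) even)
      (λ y Tᵈy≡y → tabulateℕ t (w y) ,
        trans (cong (λ s₁ → state s₁ (tabulateℕ t (w y))) (sym (proj₁ (onto y Tᵈy≡y))))
              (state-onto y (proj₂ (onto y Tᵈy≡y))))

  private
    cofactor-≤ : ∀ {t q} → m ≡ q * t → t ≤ m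
    cofactor-≤ {t} {suc q} m≡qt = subst (t ≤_) (sym m≡qt) (ℕP.m≤m+n t (q * t))

    A-constant : γ ≡ false → ∀ {t} s₀ → Periodic t (A s₀)
    A-constant γ≡false {t} s₀ j = trans (A-γ≡false γ≡false s₀ (j + t)) (sym (A-γ≡false γ≡false s₀ j))

  #Fix-2*odd-cofactor : ∀ t′ {q} → m ≡ q * suc t′ → parity q ≡ true → #Fix T (2 * suc t′) ≡ 2 ^ suc (suc t′)
  #Fix-2*odd-cofactor t′ {q} m≡qt odd = #Fix-free even into onto
    where
    t = suc t′
    open Parametrisation (cofactor-≤ {t} {q} m≡qt) A
    A-per : ∀ s₀ → Periodic t (A s₀)
    A-per = A-periodic (trans (sym (trans (cong parity m≡qt) (trans (parity-* q t) (cong (_∧ parity t) odd)))) refl)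
    even : (parity (2 * t) ∧ γ) ≡ false
    even = cong (_∧ γ) (parity-2* t)
    into : ∀ s₀ b → Recurrent m (A s₀) (orbit s₀ b) × Periodic (2 * t) (orbit s₀ b)
    into s₀ b = subst (λ k → Recurrent k (A s₀) (orbit s₀ b)) (sym m≡qt)
                      (recurrent-odd-* {v = orbit s₀ b} {q} rec (A-per s₀) odd)
              , recurrent⇒periodic-2* {v = orbit s₀ b} rec (A-per s₀)
      where
      rec = solution-recurrent (A s₀) (b !_)
    onto : ∀ y → iterate T (2 * t) y ≡ y → Recurrent t (A (s y)) (w y)
    onto y Tᵈy≡y with parity≡true⇒2*+1 q odd
    ... | h , refl = recurrent-odd-/ h (subst (λ k → Recurrent k (A (s y)) (w y)) m≡qt (w-recurrence y))
                                     (fixed⇒w-periodic (periodic-* (A-per (s y)) 2) Tᵈy≡y)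

  #Fix-odd-cofactor : ∀ {d e} → 1 ≤ d → m + m ≡ e * d → parity e ≡ true → #Fix T d ≡ 2 ^ (d / 2 + 1)
  #Fix-odd-cofactor {d} {e} 1≤d m+m≡ed odd with odd-cofactor⇒even {m} {d} {e} m+m≡ed odd 1≤d
  ... | t′ , refl , m≡et = trans (#Fix-2*odd-cofactor t′ {e} m≡et odd) (cong (2 ^_) (sym (2*[1+t]/2+1 t′)))

  #Fix-divisor-free : γ ≡ false → (∀ s₀ j → A s₀ j ≡ false) → ∀ {d} → 1 ≤ d → d ∣ m → #Fix T d ≡ 2 ^ (d + 1)
  #Fix-divisor-free γ≡false A≡false {suc t′} _ (divides q m≡qt) =
    trans (#Fix-free even into onto) (cong (2 ^_) (ℕP.+-comm 1 (suc t′)))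
    where
    t = suc t′
    open Parametrisation (cofactor-≤ {t} {q} m≡qt) (λ _ _ → false)
    even : (parity t ∧ γ) ≡ false
    even = trans (cong (parity t ∧_) γ≡false) (∧-zeroʳ (parity t))
    into : ∀ s₀ b → Recurrent m (A s₀) (orbit s₀ b) × Periodic t (orbit s₀ b)
    into s₀ b = subst (λ k → Recurrent k (A s₀) (orbit s₀ b)) (sym m≡qt) (periodic⇒recurrent-* q per (A≡false s₀)) , per
      where
      per = recurrent-false⇒periodic (solution-recurrent (λ _ → false) (b !_))
    onto : ∀ y → iterate T t y ≡ y → Recurrent t (λ _ → false) (w y)
    onto y Tᵗy≡y j = trans (fixed⇒w-periodic (A-constant γ≡false (s y)) Tᵗy≡y j) (sym (xor-identityʳ (w y j)))

  #Fix-divisor-pinned : γ ≡ false → τ ≡ true → ∀ {d} → 1 ≤ d → d ∣ m → #Fix T d ≡ 2 ^ d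
  #Fix-divisor-pinned γ≡false τ≡true {suc t′} _ (divides q m≡qt) = #Fix-pinned ε even into onto
    where
    t = suc t′
    open Parametrisation (cofactor-≤ {t} {q} m≡qt) (λ _ _ → false)
    even : (parity t ∧ γ) ≡ false
    even = trans (cong (parity t ∧_) γ≡false) (∧-zeroʳ (parity t))
    A-ε≡false : ∀ j → A ε j ≡ false
    A-ε≡false j = trans (A-γ≡false γ≡false ε j) (trans (cong (λ t′ → (t′ ∧ ε) xor ε) τ≡true) (xor-same ε))
    into : ∀ b → Recurrent m (A ε) (orbit ε b) × Periodic t (orbit ε b)
    into b = subst (λ k → Recurrent k (A ε) (orbit ε b)) (sym m≡qt) (periodic⇒recurrent-* q per A-ε≡false) , per
      where
      per = recurrent-false⇒periodic (solution-recurrent (λ _ → false) (b !_))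
    onto : ∀ y → iterate T t y ≡ y → s y ≡ ε × Recurrent t (λ _ → false) (w y)
    onto y Tᵗy≡y = s≡ε , λ j → trans (per j) (sym (xor-identityʳ (w y j)))
      where
      per = fixed⇒w-periodic (A-constant γ≡false (s y)) Tᵗy≡y
      A≡false : A (s y) 0 ≡ false
      A≡false = recurrent∧periodic⇒vanishing {q} (subst (λ k → Recurrent k (A (s y)) (w y)) m≡qt (w-recurrence y)) per 0
      s≡ε : s y ≡ ε
      s≡ε = xor-≡false⇒≡ (trans (sym (trans (A-γ≡false γ≡false (s y) 0) (cong (λ t′ → (t′ ∧ s y) xor ε) τ≡true))) A≡false)

  iterate-2m : ∀ y → iterate T (m + m) y ≡ y
  iterate-2m y = iterate-fixed⇐ even (λ i _ → w-per i)
    where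
    even : (parity (m + m) ∧ γ) ≡ false
    even = cong (_∧ γ) (trans (parity-+ m m) (xor-same (parity m)))
    w-per : ∀ i → w y (i + (m + m)) ≡ w y i
    w-per i = begin
      w y (i + (m + m))                            ≡⟨ cong (w y) (ℕP.+-assoc i m m) ⟨
      w y (i + m + m)                              ≡⟨ w-recurrence y (i + m) ⟩
      w y (i + m) xor A (s y) (i + m)              ≡⟨ cong₂ _xor_ (w-recurrence y i) (A-periodic refl (s y) i) ⟩
      (w y i xor A (s y) i) xor A (s y) i          ≡⟨ xor-assoc (w y i) (A (s y) i) (A (s y) i) ⟩
      w y i xor (A (s y) i xor A (s y) i)          ≡⟨ cong (w y i xor_) (xor-same (A (s y) i)) ⟩
      w y i xor false                              ≡⟨ xor-identityʳ (w y i) ⟩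
      w y i                                        ∎
      where open ≡-Reasoning

  iterate-m⇒A≡false : ∀ {y} → iterate T m y ≡ y → ∀ i → i < m → A (s y) i ≡ false
  iterate-m⇒A≡false {y} Tᵐy≡y i i<m =
    xor-cancelˡ (w y i) (trans (sym (w-recurrence y i)) (proj₂ (iterate-fixed⇒ Tᵐy≡y) i i<m))

  hasFixedPoint⇒ : HasFixedPoint T → γ ≡ false × (τ ≡ true ⊎ ε ≡ false)
  hasFixedPoint⇒ (x , Tx≡x) = γ≡false , τ-cases τ refl
    where
    γ≡false : γ ≡ false
    γ≡false = proj₁ (iterate-fixed⇒ {1} Tx≡x)
    A≡false : (τ ∧ s x) xor ε ≡ false
    A≡false = trans (sym (A-γ≡false γ≡false (s x) 0))
      (recurrent∧periodic⇒vanishing {m} (subst (λ k → Recurrent k (A (s x)) (w x)) (sym (ℕP.*-identityʳ m)) (w-recurrence x))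
                                     (fixed⇒w-periodic (A-constant γ≡false (s x)) Tx≡x) 0)
    τ-cases : ∀ b → τ ≡ b → τ ≡ true ⊎ ε ≡ false
    τ-cases true  τ≡true  = inj₁ τ≡true
    τ-cases false τ≡false = inj₂ (trans (sym (cong (λ t → (t ∧ s x) xor ε) τ≡false)) A≡false)

  hasFixedPoint⇐ : γ ≡ false → τ ≡ true ⊎ ε ≡ false → HasFixedPoint T
  hasFixedPoint⇐ γ≡false τ∨ε =
    x , iterate-fixed⇐ {1} γ≡false (λ i _ → trans (w≡false (i + 1)) (sym (w≡false i)))
    where
    s₀ = if τ then ε else false
    x = Ψ s₀ (λ _ → false)
    A≡false : ∀ j → A s₀ j ≡ false
    A≡false j = trans (A-γ≡false γ≡false s₀ j) (vanish τ ε τ∨ε)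
      where
      vanish : ∀ t e → t ≡ true ⊎ e ≡ false → (t ∧ (if t then e else false)) xor e ≡ false
      vanish true  e _            = xor-same e
      vanish false e (inj₂ refl) = refl
    w≡false : ∀ j → w x j ≡ false
    w≡false = w-unique x (λ j → sym (trans (cong (λ s₁ → A s₁ j) (s-Ψ s₀ (λ _ → false))) (A≡false j)))
                         (λ i i<m → sym (u-Ψ s₀ (λ _ → false) i<m))

  ¬hasFixedPoint⇒ : ¬ HasFixedPoint T → γ ≡ true ⊎ (τ ≡ false × ε ≡ true)
  ¬hasFixedPoint⇒ no-fixed-point = cases γ τ ε refl refl refl
    where
    cases : ∀ a b c → γ ≡ a → τ ≡ b → ε ≡ c → γ ≡ true ⊎ (τ ≡ false × ε ≡ true)
    cases true  _     _     γ≡true  _       _       = inj₁ γ≡true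
    cases false true  _     γ≡false τ≡true  _       = contradiction (hasFixedPoint⇐ γ≡false (inj₁ τ≡true)) no-fixed-point
    cases false false false γ≡false _       ε≡false = contradiction (hasFixedPoint⇐ γ≡false (inj₂ ε≡false)) no-fixed-point
    cases false false true  _       τ≡false ε≡true  = inj₂ (τ≡false , ε≡true)

  iterate-m : τ ≡ false → γ ≡ false → ε ≡ false → ∀ y → iterate T m y ≡ y
  iterate-m τ≡false γ≡false ε≡false y =
    iterate-fixed⇐ (trans (cong (parity m ∧_) γ≡false) (∧-zeroʳ (parity m)))
                   (λ i _ → trans (w-recurrence y i) (trans (cong (w y i xor_) (A≡false i)) (xor-identityʳ (w y i))))
    where
    A≡false : ∀ i → A (s y) i ≡ false
    A≡false i rewrite A-γ≡false γ≡false (s y) i | τ≡false = ε≡false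

  iterate-m-moves : 1 ≤ m′ → γ ≡ true ⊎ (τ ≡ false × ε ≡ true) → ∀ y → iterate T m y ≢ y
  iterate-m-moves 1≤m′ (inj₁ γ≡true) y Tᵐy≡y =
    differ (s y) ε (trans (sym (A-at 0)) (trans (A≡false 0 (s≤s z≤n)) (trans (sym (A≡false 1 (s≤s 1≤m′))) (A-at 1))))
    where
    A≡false = iterate-m⇒A≡false Tᵐy≡y
    τ≡true : τ ≡ true
    τ≡true = trans (sym (not-involutive τ))
      (cong not (trans (sym (∧-identityʳ (parity m)))
                       (trans (cong (parity m ∧_) (sym γ≡true)) (proj₁ (iterate-fixed⇒ {m} {y} Tᵐy≡y)))))
    A-at : ∀ j → A (s y) j ≡ (s y xor parity j) xor ε
    A-at j = trans (cong₂ (λ t g → (t ∧ (s y xor (parity j ∧ g))) xor ε) τ≡true γ≡true)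
                   (cong (λ p → (s y xor p) xor ε) (∧-identityʳ (parity j)))
    differ : ∀ a e → ((a xor false) xor e) ≢ ((a xor true) xor e)
    differ false false ()
    differ false true  ()
    differ true  false ()
    differ true  true  ()
  iterate-m-moves 1≤m′ (inj₂ (τ≡false , ε≡true)) y Tᵐy≡y =
    contradiction (trans (sym A₀≡true) (iterate-m⇒A≡false Tᵐy≡y 0 (s≤s z≤n))) (λ ())
    where
    A₀≡true : A (s y) 0 ≡ true
    A₀≡true = cong₂ (λ t e → (t ∧ (s y xor (false ∧ γ))) xor e) τ≡false ε≡true

module Main (m′ : ℕ) (1≤m′ : 1 ≤ m′) (f : Fin (suc (suc m′)) → LocalFn) where

  open Möbius using (Σ∣)
  open MöbiusInversion using (divSum-inversion; oddDivSum-inversion)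
  open PeriodicPoints using (#Fix; fixed?; #Fix≡Σ∣numPer; period-∣; least-period; iterate-*)
  open Enumeration using (length-filter-allVecs-none)
  open Parity
  open Cofactors
  open Sweep m′ f using (m; n)
  open ShiftRegister m′ f using (T; γ; τ; ε; A; A-γ≡false)
  open FixedPoints m′ f
  open import Defs using (μ; ξ; divSum; oddDivSum; _∣ₒ_; Even; Odd; numPer; IsPeriodic; isPeriodic?; HasFixedPoint;
                          iterate)
  open import Data.Nat using (_+_; _*_; _∸_; _^_; _/_)
  open import Data.Nat.Divisibility using (_∣_; _∣?_; divides; ∣-trans)
  open import Data.Empty using (⊥)

  2n∸2≡m+m : 2 * n ∸ 2 ≡ m + m
  2n∸2≡m+m = 2*[1+m]∸2≡m+m m

  Σ∣numPer≡#Fix : ∀ {d} → 1 ≤ d → Σ∣ d (λ p → + numPer T p) ≡ + #Fix T d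
  Σ∣numPer≡#Fix 1≤d = sym (#Fix≡Σ∣numPer T 1≤d)

  even⇒τ≡false : Even n → τ ≡ false
  even⇒τ≡false even = trans (sym (not-involutive τ)) (even⇒parity≡false even)

  odd⇒τ≡true : Odd n → τ ≡ true
  odd⇒τ≡true odd = trans (sym (not-involutive τ)) (odd⇒parity≡true odd)

  no-periodic-point : ∀ {r} → (∀ x → ¬ IsPeriodic T r x) → numPer T r ≡ 0
  no-periodic-point {r} = length-filter-allVecs-none (isPeriodic? T r)

  ξ-∣ : ∀ {d} → d ∣ m → ξ n d ≡ + (2 ^ d)
  ξ-∣ {d} d∣m with d ∣? m
  ... | yes _   = refl
  ... | no d∤m = contradiction d∣m d∤m

  ξ-∤ : ∀ {d} → ¬ d ∣ m → ξ n d ≡ + (2 ^ (d / 2 + 1))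
  ξ-∤ {d} d∤m with d ∣? m
  ... | yes d∣m = contradiction d∣m d∤m
  ... | no _    = refl

  module WithFixedPoint (fixed-point : HasFixedPoint T) where

    γ≡false : γ ≡ false
    γ≡false = proj₁ (hasFixedPoint⇒ fixed-point)

    τ≡false⇒ε≡false : τ ≡ false → ε ≡ false
    τ≡false⇒ε≡false τ≡false with proj₂ (hasFixedPoint⇒ fixed-point)
    ... | inj₁ τ≡true  = contradiction (trans (sym τ≡false) τ≡true) (λ ())
    ... | inj₂ ε≡false = ε≡false

    numPer-even : ∀ {r} → 0 < r → (r ∣ n ∸ 1) × Even n → + numPer T r ≡ divSum r (λ d q → μ q ℤ.* + (2 ^ (d + 1)))
    numPer-even {r} 1≤r (r∣m , even) = sym (divSum-inversion 1≤r _ _ Σ∣≡)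
      where
      τ≡false = even⇒τ≡false even
      A≡false : ∀ s₀ j → A s₀ j ≡ false
      A≡false s₀ j = trans (A-γ≡false γ≡false s₀ j) (trans (cong (λ t → (t ∧ s₀) xor ε) τ≡false) (τ≡false⇒ε≡false τ≡false))
      Σ∣≡ : ∀ d → d ∣ r → 1 ≤ d → Σ∣ d (λ p → + numPer T p) ≡ + (2 ^ (d + 1))
      Σ∣≡ d d∣r 1≤d = trans (Σ∣numPer≡#Fix 1≤d) (cong +_ (#Fix-divisor-free γ≡false A≡false 1≤d (∣-trans d∣r r∣m)))

    numPer-odd : ∀ {r} → 0 < r → (r ∣ 2 * n ∸ 2) × Odd n → + numPer T r ≡ divSum r (λ d q → μ q ℤ.* ξ n d)
    numPer-odd {r} 1≤r (r∣2n∸2 , odd) = sym (divSum-inversion 1≤r _ _ Σ∣≡)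
      where
      r∣2m = subst (r ∣_) 2n∸2≡m+m r∣2n∸2
      Σ∣≡ : ∀ d → d ∣ r → 1 ≤ d → Σ∣ d (λ p → + numPer T p) ≡ ξ n d
      Σ∣≡ d d∣r 1≤d = trans (Σ∣numPer≡#Fix 1≤d) (#Fix≡ξ (d ∣? m))
        where
        #Fix≡ξ : Dec (d ∣ m) → + #Fix T d ≡ ξ n d
        #Fix≡ξ (yes d∣m) = trans (cong +_ (#Fix-divisor-pinned γ≡false (odd⇒τ≡true odd) 1≤d d∣m)) (sym (ξ-∣ d∣m))
        #Fix≡ξ (no d∤m)  = trans (cong +_ (#Fix-odd-cofactor {d} {e} 1≤d m+m≡ed (cofactor-odd {m} {d} {e} m+m≡ed d∤m)))
                                 (sym (ξ-∤ d∤m))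
          where
          open _∣_ (∣-trans d∣r r∣2m) renaming (quotient to e; equality to m+m≡ed)

    numPer-other : ∀ {r} → 0 < r → ¬ ((r ∣ n ∸ 1) × Even n) → ¬ ((r ∣ 2 * n ∸ 2) × Odd n) → numPer T r ≡ 0
    numPer-other {r} 1≤r ¬even ¬odd = no-periodic-point none
      where
      none : ∀ x → ¬ IsPeriodic T r x
      none x per = by-parity (2 ∣? n)
        where
        by-parity : Dec (Even n) → ⊥
        by-parity (yes even) = ¬even (period-∣ T 1≤r per (iterate-m τ≡false γ≡false (τ≡false⇒ε≡false τ≡false) x) , even)
          where τ≡false = even⇒τ≡false even
        by-parity (no odd)   = ¬odd (subst (r ∣_) (sym 2n∸2≡m+m) (period-∣ T 1≤r per (iterate-2m x)) , odd)

  module WithoutFixedPoint (no-fixed-point : ¬ HasFixedPoint T) where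

    period-∣ₒ : ∀ {p x} → 1 ≤ p → IsPeriodic T p x → p ∣ₒ (m + m)
    period-∣ₒ {p} {x} 1≤p per with period-∣ T 1≤p per (iterate-2m x)
    ... | divides e m+m≡ep = e , m+m≡ep , e-odd
      where
      e-odd : ¬ 2 ∣ e
      e-odd 2∣e with even-cofactor⇒∣ m+m≡ep 2∣e
      ... | divides q m≡qp =
        iterate-m-moves 1≤m′ (¬hasFixedPoint⇒ no-fixed-point) x
                        (subst (λ j → iterate T j x ≡ x) (sym m≡qp) (iterate-* T (proj₁ per) q))

    numPer-odd : ∀ {r} → 0 < r → r ∣ₒ (2 * n ∸ 2) → + numPer T r ≡ oddDivSum r (λ d q → μ q ℤ.* + (2 ^ (d / 2 + 1)))
    numPer-odd {r} 1≤r (q , 2n∸2≡qr , q-odd) = sym (oddDivSum-inversion 1≤r _ _ Σ∣≡ Σ∣≡0)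
      where
      m+m≡qr = trans (sym 2n∸2≡m+m) 2n∸2≡qr
      Σ∣≡ : ∀ d → d ∣ₒ r → 1 ≤ d → Σ∣ d (λ p → + numPer T p) ≡ + (2 ^ (d / 2 + 1))
      Σ∣≡ d (q′ , r≡q′d , q′-odd) 1≤d = trans (Σ∣numPer≡#Fix 1≤d) (cong +_ (#Fix-odd-cofactor {d} {q * q′} 1≤d
        (trans m+m≡qr (trans (cong (q *_) r≡q′d) (sym (ℕP.*-assoc q q′ d))))
        (trans (parity-* q q′) (cong₂ _∧_ (odd⇒parity≡true q-odd) (odd⇒parity≡true q′-odd)))))
      Σ∣≡0 : ∀ d → d ∣ r → ¬ d ∣ₒ r → 1 ≤ d → Σ∣ d (λ p → + numPer T p) ≡ + 0
      Σ∣≡0 d d∣r ¬odd 1≤d = trans (Σ∣numPer≡#Fix 1≤d) (cong +_ (length-filter-allVecs-none (fixed? T d) unfixed))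
        where
        unfixed : ∀ x → ¬ iterate T d x ≡ x
        unfixed x Tᵈx≡x = contradict (least-period T 1≤d Tᵈx≡x)
          where
          contradict : (∃ λ p → 1 ≤ p × p ∣ d × IsPeriodic T p x) → ⊥
          contradict (p , 1≤p , p∣d , per) = ¬odd (∣ₒ-transfer 1≤p (period-∣ₒ 1≤p per) (q , m+m≡qr , q-odd) d∣r p∣d)

    numPer-other : ∀ {r} → 0 < r → ¬ (r ∣ₒ (2 * n ∸ 2)) → numPer T r ≡ 0
    numPer-other {r} 1≤r ¬odd = no-periodic-point λ x per →
      let (e , m+m≡er , e-odd) = period-∣ₒ 1≤r per in ¬odd (e , trans 2n∸2≡m+m m+m≡er , e-odd)

open import Defs using (HasFixedPoint; numPer; μ; ξ; divSum; oddDivSum; _∣ₒ_; Even; Odd)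
open import Data.Nat using (_+_; _*_; _∸_; _^_; _/_)
open import Data.Nat.Divisibility using (_∣_)

theorem4p9 : (n r : ℕ) → 3 ≤ n → 0 < r → (f : Fin n → LocalFn) →
  (HasFixedPoint (SDS f) →
      ((r ∣ n ∸ 1) × Even n →
         + numPer (SDS f) r ≡ divSum r (λ d q → μ q ℤ.* + (2 ^ (d + 1))))
    × ((r ∣ 2 * n ∸ 2) × Odd n →
         + numPer (SDS f) r ≡ divSum r (λ d q → μ q ℤ.* ξ n d))
    × (¬ ((r ∣ n ∸ 1) × Even n) → ¬ ((r ∣ 2 * n ∸ 2) × Odd n) →
         numPer (SDS f) r ≡ 0))
  × (¬ HasFixedPoint (SDS f) →
      (r ∣ₒ (2 * n ∸ 2) →
         + numPer (SDS f) r ≡ oddDivSum r (λ d q → μ q ℤ.* + (2 ^ (d / 2 + 1))))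
    × (¬ (r ∣ₒ (2 * n ∸ 2)) → numPer (SDS f) r ≡ 0))
theorem4p9 _ r (s≤s (s≤s (s≤s {n = k} z≤n))) 0<r f =
  (λ fixed → let open Main.WithFixedPoint (suc k) (s≤s z≤n) f fixed
             in numPer-even 0<r , numPer-odd 0<r , numPer-other 0<r) ,
  (λ unfixed → let open Main.WithoutFixedPoint (suc k) (s≤s z≤n) f unfixed
               in numPer-odd 0<r , numPer-other 0<r)
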